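{- Let $n\ge 1$. The map $\Phi$ defined below is a well-defined bijection from $\mathfrak{W}_n$, the set of weakly increasing $3$-dimensional permutations of length $n$, onto $\mathcal{S}_n$, the set of snakes of length $n$.
   Context: $\mathfrak{S}_n$ is the set of permutations of $[n]=\{1,\dots,n\}$. A weakly increasing $3$-dimensional permutation of length $n$ is a pair $(\sigma,\pi)\in\mathfrak{S}_n^2$ with $\max(\sigma_1,\pi_1)\le\max(\sigma_2,\pi_2)\le\cdots\le\max(\sigma_n,\pi_n)$; $\mathfrak{W}_n$ is the set of these. A signed permutation of length $n$ is a word $p_1\cdots p_n$ with $p_i=\pm\rho_i$ for some $\rho\in\mathfrak{S}_n$. A snake of length $n$ is a signed permutation $p$ with $p_1>0$ and $p_1>p_2<p_3>p_4<\cdots$ (descent at odd positions, ascent at even positions); $\mathcal{S}_n$ is the set of snakes. For $\tau\in\mathfrak{S}_n$, a letter $k\in\{2,\dots,n\}$ is a cycle peak of $\tau$ if $\tau^{ -1}(k)<k>\tau(k)$. The standard cycle form of $\tau$ writes each cycle with its largest letter first and lists cycles from left to right in increasing order of their largest letters; Foata's map $f(\tau)$ is the word obtained by erasing all parentheses of the standard cycle form. For a word $u=u_1\cdots u_n$ of distinct positive integers, set $u_0=0$, $u_{n+1}=+\infty$; $u_i$ is a left peak if $u_{i-1}<u_i>u_{i+1}$ and a right valley if $u_{i-1}>u_i<u_{i+1}$. Construction of $\Phi(\sigma,\pi)$: (1) Let $\tau\in\mathfrak{S}_n$ be defined by $\tau(\sigma_i)=\pi_i$ for all $i$; a cycle peak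 $k$ of $\tau$ is declared "hatted" if and only if $k=\sigma_\ell=\pi_{\ell+1}$ for some $\ell\in[n-1]$. (2) Let $\tilde\tau=f(\tau)$, carrying the hats along (hatted letters become left peaks of $\tilde\tau$). (3) Associate to each right valley of $\tilde\tau$ the closest left peak of $\tilde\tau$ to its left. Define $p=\Phi(\sigma,\pi)$ by $p_i=-\tilde\tau_i$ if either ($i$ is even and $\tilde\tau_i$ is not a right valley) or ($\tilde\tau_i$ is a right valley whose associated left peak is hatted), and $p_i=\tilde\tau_i$ otherwise. -}

module Defs where

open import Data.Bool using (Bool; true; false; if_then_else_; _∧_; _∨_; not)
open import Data.Nat using (ℕ; zero; suc; _⊔_; _≤_; _<ᵇ_; _≡ᵇ_)
open import Data.Integer using (ℤ; +_; -_; ∣_∣) renaming (_<_ to _<ℤ_)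
open import Data.List using (List; []; _∷_; map; upTo; zipWith; length; concatMap; filterᵇ; drop; zip)
open import Data.Bool.ListAction using (all; any)
open import Data.List.Relation.Unary.Linked using (Linked)
open import Data.List.Relation.Binary.Permutation.Propositional using (_↭_)
open import Data.Product using (_×_; _,_; proj₁; proj₂)
open import Data.Unit using (⊤)
open import Data.Empty using (⊥)

-- Basic objects.  Words are lists; position i of the paper is the
-- i-th entry (1-based) of the list.

range : ℕ → List ℕ
range n = map suc (upTo n)

IsPerm : ℕ → List ℕ → Set
IsPerm n σ = σ ↭ range n

IsWeaklyIncreasing3 : ℕ → List ℕ → List ℕ → Set
IsWeaklyIncreasing3 n σ π =
  IsPerm n σ × IsPerm n π × Linked _≤_ (zipWith _⊔_ σ π)

IsSignedPerm : ℕ → List ℤ → Set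
IsSignedPerm n p = map ∣_∣ p ↭ range n

Down Up : List ℤ → Set
Down (x ∷ y ∷ r) = (y <ℤ x) × Up (y ∷ r)
Down _ = ⊤
Up (x ∷ y ∷ r) = (x <ℤ y) × Down (y ∷ r)
Up _ = ⊤

PositiveHead : List ℤ → Set
PositiveHead [] = ⊥
PositiveHead (x ∷ _) = + 0 <ℤ x

IsSnake : ℕ → List ℤ → Set
IsSnake n p = IsSignedPerm n p × PositiveHead p × Down p

-- lookupAssoc xs ys k = ys_i where xs_i = k  (0 if k does not occur)
lookupAssoc : List ℕ → List ℕ → ℕ → ℕ
lookupAssoc (x ∷ xs) (y ∷ ys) k = if x ≡ᵇ k then y else lookupAssoc xs ys k
lookupAssoc _ _ k = 0

tau : List ℕ → List ℕ → ℕ → ℕ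
tau σ π = lookupAssoc σ π

tauInv : List ℕ → List ℕ → ℕ → ℕ
tauInv σ π = lookupAssoc π σ

cycleFrom : (ℕ → ℕ) → ℕ → ℕ → List ℕ
cycleFrom f fuel m = m ∷ go fuel (f m)
  where
  go : ℕ → ℕ → List ℕ
  go zero _ = []
  go (suc k) x = if x ≡ᵇ m then [] else x ∷ go k (f x)

isCycleMax : (ℕ → ℕ) → ℕ → ℕ → Bool
isCycleMax f fuel m = all (λ x → x Data.Nat.≤ᵇ m) (cycleFrom f fuel m)

-- Foata's map applied to τ: erase the parentheses of the standard
-- cycle form (each cycle written with its largest letter first, cycles
-- in increasing order of their largest letters).
foata : ℕ → (ℕ → ℕ) → List ℕ
foata n f = concatMap (cycleFrom f n) (filterᵇ (isCycleMax f n) (range n))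

isCyclePeak : List ℕ → List ℕ → ℕ → Bool
isCyclePeak σ π k = (1 <ᵇ k) ∧ (tauInv σ π k <ᵇ k) ∧ (tau σ π k <ᵇ k)

isHatted : List ℕ → List ℕ → ℕ → Bool
isHatted σ π k =
  isCyclePeak σ π k ∧
  any (λ q → (proj₁ q ≡ᵇ k) ∧ (proj₂ q ≡ᵇ k)) (zip σ (drop 1 π))

-- Scan ũ left to right, with u₀ = 0 and u_{n+1} = +∞.
--   prev  : u_{i-1}
--   h     : is the closest left peak seen so far (to the left) hatted?
--   ev    : is the current position i even?
-- x < head (with head of [] = +∞)
headBigger : ℕ → List ℕ → Bool
headBigger x [] = true
headBigger x (y ∷ _) = x <ᵇ y

headSmaller : ℕ → List ℕ → Bool
headSmaller x [] = false
headSmaller x (y ∷ _) = y <ᵇ x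

signs : (ℕ → Bool) → ℕ → Bool → Bool → List ℕ → List ℤ
signs hat prev h ev [] = []
signs hat prev h ev (x ∷ rest) =
  (if neg then - (+ x) else + x) ∷ signs hat x h' (not ev) rest
  where
  nextBigger : Bool
  nextBigger = headBigger x rest
  nextSmaller : Bool
  nextSmaller = headSmaller x rest
  isLeftPeak : Bool
  isLeftPeak = (prev <ᵇ x) ∧ nextSmaller
  isRightValley : Bool
  isRightValley = (x <ᵇ prev) ∧ nextBigger
  h' : Bool
  h' = if isLeftPeak then hat x else h
  neg : Bool
  neg = (ev ∧ not isRightValley) ∨ (isRightValley ∧ h)

Φ : List ℕ → List ℕ → List ℤ
Φ σ π = signs (isHatted σ π) 0 false false (foata (length σ) (tau σ π))

-- Φ is a composite of three bijections.
--
-- The word w = f(τ) determines τ: its cycles are recovered by cutting w in front of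
-- each left-to-right maximum, since every cycle is written from its largest letter and the cycles
-- are sorted by these.  Moreover, with u₀ = 0, a letter of w is a left peak exactly when it is a
-- cycle peak of τ: inside a cycle the neighbours in the word are the neighbours in the cycle, and
-- where they differ (around the maximum and the last letter of a cycle) they compare alike.
--
-- In a weakly increasing pair (σ, π) the columns (σᵢ, πᵢ) are sorted by their maxima, and a
-- value k is the maximum of two columns exactly when k is a cycle peak of τ; k is hatted exactly
-- when the column with σᵢ = k comes first.  So (σ, π) is recovered from τ and its set of hatted
-- cycle peaks by sorting [n] by a suitable key, and every set of cycle peaks arises.
--
-- In a snake every sign is forced by the alternation except at the right valleys, whose
-- signs are the hats of the associated left peaks.  So the signs determine the hats of all left
-- peaks, that is of all cycle peaks, and every snake arises from some choice of hats.

module Submission where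

open import Defs
open import Data.Bool using (Bool; true; false; if_then_else_; _∧_; _∨_; not; T)
open import Data.Bool.Properties using (∧-zeroʳ; not-involutive; T-≡; T-∧)
open import Data.Bool.ListAction using (any)
open import Data.Empty using (⊥; ⊥-elim)
open import Data.Integer.Base using (ℤ; +_; -[1+_]; -_; ∣_∣; -<+; -<-; +<+) renaming (_<_ to _<ℤ_)
open import Data.Nat
  using (ℕ; zero; suc; _+_; _*_; _∸_; _⊔_; _≤_; _<_; _≥_; _<ᵇ_; _≡ᵇ_; _≤ᵇ_; z≤n; s≤s; z<s; s<s; s≤s⁻¹)
open import Data.Nat.Properties
open import Data.Nat.Induction using (<-rec)
open import Data.Nat.GeneralisedArithmetic using (iterate)
open import Data.List using (List; []; _∷_; map; upTo; applyUpTo; length; _++_; concat; filterᵇ; zip; drop; zipWith)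
open import Data.List.Properties
  using (length-map; length-upTo; length-applyUpTo; filter-notAll; map-++; ++-assoc; ∷-injectiveˡ; ∷-injectiveʳ;
         map-∘; map-id-local; map-cong-local)
open import Data.List.Extrema ≤-totalOrder using (max; ⊥≤max; xs≤max; argmax-all)
open import Data.List.Membership.Propositional using (_∈_; _∉_; lose; find)
open import Data.List.Membership.Propositional.Properties
  using (∈-map⁺; ∈-map⁻; ∈-upTo⁺; ∈-upTo⁻; ∈-++⁺ˡ; ∈-++⁺ʳ; ∈-++⁻; ∈-concat⁺′; ∈-concat⁻′;
         ∈-filter⁺; ∈-filter⁻; ∈-applyUpTo⁺; ∈-applyUpTo⁻)
open import Data.List.Membership.Propositional.Properties.WithK using (unique∧set⇒bag)
open import Data.List.Relation.Unary.Any as Any using (here; there)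
open import Data.List.Relation.Unary.Any.Properties using (any⁺; any⁻)
open import Data.List.Relation.Unary.All as All using (All; []; _∷_)
open import Data.List.Relation.Unary.All.Properties using (All¬⇒¬Any; all⁺; all⁻)
  renaming (++⁺ to All-++⁺; ++⁻ˡ to All-++⁻ˡ)
open import Data.List.Relation.Unary.AllPairs as AllPairs using (AllPairs; []; _∷_)
import Data.List.Relation.Unary.AllPairs.Properties as AllPairs
open import Data.List.Relation.Unary.Linked as Linked using (Linked; []; [-]; _∷_)
import Data.List.Relation.Unary.Linked.Properties as Linked
open import Data.List.Relation.Unary.Linked.Properties using (Linked⇒AllPairs)
open import Data.List.Relation.Unary.Unique.Propositional using (Unique)
import Data.List.Relation.Unary.Unique.Propositional.Properties as Unique
open import Data.List.Relation.Binary.Disjoint.Propositional using (Disjoint)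
open import Data.List.Relation.Binary.Permutation.Propositional using (_↭_; ↭-sym; ↭-refl; ↭⇒↭ₛ)
open import Data.List.Relation.Binary.Permutation.Propositional.Properties using (∈-resp-↭; ↭-length; ∷↭∷ʳ)
import Data.List.Relation.Binary.Permutation.Propositional.Properties as ↭
import Data.List.Relation.Binary.Permutation.Setoid.Properties as Permutationₛ
open import Data.List.Relation.Binary.BagAndSetEquality using (∼bag⇒↭)
open import Data.Product using (_×_; _,_; proj₁; proj₂; ∃; ∃₂)
open import Data.Sum using (_⊎_; inj₁; inj₂)
open import Data.Unit using (⊤; tt)
open import Function using (_∘_; _⇔_; Equivalence; case_of_)
open import Function.Bundles using (mk⇔)
open import Function.Construct.Composition using (_⇔-∘_)
open import Relation.Binary.Definitions using (tri<; tri≈; tri>)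
import Relation.Binary.Construct.On as On
open import Relation.Binary.PropositionalEquality
  using (_≡_; _≢_; refl; sym; trans; cong; cong₂; subst; subst₂; setoid; module ≡-Reasoning)
open import Relation.Nullary using (¬_; Dec; yes; no; contradiction; ¬?; _×-dec_)
open import Relation.Nullary.Decidable using (T?)
open import Relation.Nullary.Reflects using (ofʸ; ofⁿ)

private variable
  m n x y : ℕ
  xs ys : List ℕ

<ᵇ-true : m < n → (m <ᵇ n) ≡ true
<ᵇ-true {m} {n} m<n with m <ᵇ n | <ᵇ-reflects-< m n
... | true  | _        = refl
... | false | ofⁿ m≮n = contradiction m<n m≮n

<ᵇ-false : n ≤ m → (m <ᵇ n) ≡ false
<ᵇ-false {n} {m} n≤m with m <ᵇ n | <ᵇ-reflects-< m n
... | false | _        = refl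
... | true  | ofʸ m<n = contradiction n≤m (<⇒≱ m<n)

<ᵇ-true⁻¹ : (m <ᵇ n) ≡ true → m < n
<ᵇ-true⁻¹ {m} {n} e = <ᵇ⇒< m n (subst T (sym e) tt)

≡ᵇ-true : m ≡ n → (m ≡ᵇ n) ≡ true
≡ᵇ-true {m} {n} m≡n with m ≡ᵇ n | ≡⇒≡ᵇ m n m≡n
... | true | _ = refl

≡ᵇ-false : m ≢ n → (m ≡ᵇ n) ≡ false
≡ᵇ-false {m} {n} m≢n with m ≡ᵇ n in e
... | false = refl
... | true  = contradiction (≡ᵇ⇒≡ m n (subst T (sym e) tt)) m≢n

≤ᵇ-true : m ≤ n → (m ≤ᵇ n) ≡ true
≤ᵇ-true {m} {n} m≤n with m ≤ᵇ n | ≤⇒≤ᵇ m≤n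
... | true | _ = refl

≤ᵇ-false : n < m → (m ≤ᵇ n) ≡ false
≤ᵇ-false {n} {m} n<m with m ≤ᵇ n | ≤ᵇ-reflects-≤ m n
... | false | _        = refl
... | true  | ofʸ m≤n = contradiction m≤n (<⇒≱ n<m)

≢⇒<⊎> : m ≢ n → m < n ⊎ n < m
≢⇒<⊎> {m} {n} m≢n with <-cmp m n
... | tri< m<n _ _ = inj₁ m<n
... | tri≈ _ m≡n _ = contradiction m≡n m≢n
... | tri> _ _ n<m = inj₂ n<m

Unique-resp-↭ : xs ↭ ys → Unique xs → Unique ys
Unique-resp-↭ xs↭ys = Permutationₛ.Unique-resp-↭ (setoid ℕ) (↭⇒↭ₛ xs↭ys)

Unique-++⁻ˡ : ∀ xs → Unique (xs ++ ys) → Unique xs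
Unique-++⁻ˡ []       _        = []
Unique-++⁻ˡ (x ∷ xs) (x∉ ∷ u) = All-++⁻ˡ xs x∉ ∷ Unique-++⁻ˡ xs u

Unique-++⁻ʳ : ∀ xs → Unique (xs ++ ys) → Unique ys
Unique-++⁻ʳ []       u       = u
Unique-++⁻ʳ (x ∷ xs) (_ ∷ u) = Unique-++⁻ʳ xs u

Unique-++⇒disjoint : ∀ xs → Unique (xs ++ ys) → x ∈ xs → x ∉ ys
Unique-++⇒disjoint (x ∷ xs) (x∉ ∷ _) (here refl) x∈ = All¬⇒¬Any x∉ (∈-++⁺ʳ xs x∈)
Unique-++⇒disjoint (_ ∷ xs) (_ ∷ u)  (there x∈)  = Unique-++⇒disjoint xs u x∈

Unique-concat⁻ : ∀ Ss {S} → Unique (concat Ss) → S ∈ Ss → Unique S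
Unique-concat⁻ (S ∷ Ss) u (here refl) = Unique-++⁻ˡ S u
Unique-concat⁻ (S ∷ Ss) u (there S∈)  = Unique-concat⁻ Ss (Unique-++⁻ʳ S u) S∈

unique-⊆⇒length≤ : Unique xs → (∀ {z} → z ∈ xs → z ∈ ys) → length xs ≤ length ys
unique-⊆⇒length≤ {[]}     _        _     = z≤n
unique-⊆⇒length≤ {x ∷ xs} {ys} (x∉ ∷ u) xs⊆ys = ≤-<-trans
  (unique-⊆⇒length≤ u (λ z∈ → ∈-filter⁺ (λ z → ¬? (x ≟ z)) (xs⊆ys (there z∈)) (All.lookup x∉ z∈)))
  (filter-notAll (λ z → ¬? (x ≟ z)) ys (Any.map (λ x≡z x≢z → x≢z x≡z) (xs⊆ys (here refl))))

AllPairs-map∈ : ∀ {R S : ℕ → ℕ → Set} → (∀ {a b} → a ∈ xs → b ∈ xs → R a b → S a b) →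
  AllPairs R xs → AllPairs S xs
AllPairs-map∈ h []           = []
AllPairs-map∈ h (a~as ∷ rest) = All.tabulate (λ b∈ → h (here refl) (there b∈) (All.lookup a~as b∈))
                              ∷ AllPairs-map∈ (λ a∈ b∈ → h (there a∈) (there b∈)) rest

AllPairs-total : ∀ {R : ℕ → ℕ → Set} → AllPairs R xs → x ∈ xs → y ∈ xs → x ≢ y → R x y ⊎ R y x
AllPairs-total _            (here refl) (here refl) x≢y = contradiction refl x≢y
AllPairs-total (x~xs ∷ _)   (here refl) (there y∈)  _   = inj₁ (All.lookup x~xs y∈)
AllPairs-total (y~ys ∷ _)   (there x∈)  (here refl) _   = inj₂ (All.lookup y~ys x∈)
AllPairs-total (_ ∷ sorted) (there x∈)  (there y∈)  x≢y = AllPairs-total sorted x∈ y∈ x≢y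

⊆-∷-drop : ∀ {R : ℕ → ℕ → Set} {a} → (∀ {a b} → R a b → ¬ R b a) → All (R a) xs →
  (∀ {z} → z ∈ a ∷ xs → z ∈ a ∷ ys) → ∀ {z} → z ∈ xs → z ∈ ys
⊆-∷-drop asym a~xs sub z∈ with sub (there z∈)
... | here refl  = contradiction (All.lookup a~xs z∈) λ r → asym r r
... | there z∈ys = z∈ys

sorted-≡ : ∀ {R : ℕ → ℕ → Set} → (∀ {a b} → R a b → ¬ R b a) → AllPairs R xs → AllPairs R ys →
  (∀ {z} → z ∈ xs → z ∈ ys) → (∀ {z} → z ∈ ys → z ∈ xs) → xs ≡ ys
sorted-≡ {[]}    {[]}    asym _ _ _ _ = refl
sorted-≡ {[]}    {_ ∷ _} asym _ _ _ ⊇ with () ← ⊇ (here refl)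
sorted-≡ {_ ∷ _} {[]}    asym _ _ ⊆ _ with () ← ⊆ (here refl)
sorted-≡ {x ∷ _} {_ ∷ _} asym (x~xs ∷ sx) (y~ys ∷ sy) ⊆ ⊇ with ⊆ (here refl) | ⊇ (here refl)
... | there x∈ys | there y∈xs = contradiction (All.lookup y~ys x∈ys) (asym (All.lookup x~xs y∈xs))
... | here refl  | _          = cong (x ∷_) (sorted-≡ asym sx sy (⊆-∷-drop asym x~xs ⊆) (⊆-∷-drop asym y~ys ⊇))
... | there _    | here refl  = cong (x ∷_) (sorted-≡ asym sx sy (⊆-∷-drop asym x~xs ⊆) (⊆-∷-drop asym y~ys ⊇))

least-below : (P : ℕ → Set) → (∀ t → Dec (P t)) → ∀ k →
  (∃ λ s → s < k × P s × (∀ t → t < s → ¬ P t)) ⊎ (∀ t → t < k → ¬ P t)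
least-below P P? zero = inj₂ λ _ ()
least-below P P? (suc k) with least-below P P? k
... | inj₁ (s , s<k , Ps , least) = inj₁ (s , m≤n⇒m≤1+n s<k , Ps , least)
... | inj₂ none with P? k
...   | yes Pk = inj₁ (k , ≤-refl , Pk , none)
...   | no ¬Pk = inj₂ λ t t<1+k → case m≤n⇒m<n∨m≡n (s≤s⁻¹ t<1+k) of λ where
          (inj₁ t<k)  → none t t<k
          (inj₂ refl) → ¬Pk

unique-map⇒injective : ∀ {A : Set} (f : A → ℕ) {G} → Unique (map f G) →
  ∀ {p q} → p ∈ G → q ∈ G → f p ≡ f q → p ≡ q
unique-map⇒injective f (_ ∷ _) (here refl) (here refl) _ = refl
unique-map⇒injective f {_ ∷ G} (fx∉ ∷ _) (here refl) (there q∈) e =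
  contradiction (subst (_∈ map f G) (sym e) (∈-map⁺ f q∈)) (All¬⇒¬Any fx∉)
unique-map⇒injective f {_ ∷ G} (fx∉ ∷ _) (there p∈) (here refl) e =
  contradiction (subst (_∈ map f G) e (∈-map⁺ f p∈)) (All¬⇒¬Any fx∉)
unique-map⇒injective f (_ ∷ u) (there p∈) (there q∈) e = unique-map⇒injective f u p∈ q∈ e

lookupAssoc-∈ : ∀ {A : Set} (f g : A → ℕ) {G} → Unique (map f G) → ∀ {p} → p ∈ G →
  lookupAssoc (map f G) (map g G) (f p) ≡ g p
lookupAssoc-∈ f g {q ∷ G} _ (here refl) =
  cong (if_then g q else lookupAssoc (map f G) (map g G) (f q)) (≡ᵇ-true {f q} refl)
lookupAssoc-∈ f g {q ∷ G} (fq∉ ∷ u) {p} (there p∈) = begin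
  (if f q ≡ᵇ f p then g q else lookupAssoc (map f G) (map g G) (f p))
    ≡⟨ cong (if_then g q else lookupAssoc (map f G) (map g G) (f p)) (≡ᵇ-false fq≢fp) ⟩
  lookupAssoc (map f G) (map g G) (f p)
    ≡⟨ lookupAssoc-∈ f g u p∈ ⟩
  g p ∎
  where
  open ≡-Reasoning
  fq≢fp : f q ≢ f p
  fq≢fp e = All¬⇒¬Any fq∉ (subst (_∈ map f G) (sym e) (∈-map⁺ f p∈))

lookupAssoc-map : ∀ (f : ℕ → ℕ) xs → x ∈ xs → lookupAssoc xs (map f xs) x ≡ f x
lookupAssoc-map {a} f (x ∷ xs) a∈ with x ≡ᵇ a in e
... | true  = cong f (≡ᵇ⇒≡ x a (subst T (sym e) tt))
... | false with a∈
...   | here refl  = contradiction (trans (sym e) (≡ᵇ-true {x} refl)) λ ()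
...   | there a∈xs = lookupAssoc-map f xs a∈xs

map-proj₁-zip : ∀ (xs ys : List ℕ) → length xs ≡ length ys → map proj₁ (zip xs ys) ≡ xs
map-proj₁-zip []       []       _ = refl
map-proj₁-zip (x ∷ xs) (_ ∷ ys) e = cong (x ∷_) (map-proj₁-zip xs ys (suc-injective e))

map-proj₂-zip : ∀ (xs ys : List ℕ) → length xs ≡ length ys → map proj₂ (zip xs ys) ≡ ys
map-proj₂-zip []       []       _ = refl
map-proj₂-zip (_ ∷ xs) (y ∷ ys) e = cong (y ∷_) (map-proj₂-zip xs ys (suc-injective e))

zipWith≡map-zip : ∀ (f : ℕ → ℕ → ℕ) xs ys →
  zipWith f xs ys ≡ map (λ p → f (proj₁ p) (proj₂ p)) (zip xs ys)
zipWith≡map-zip f []       _        = refl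
zipWith≡map-zip f (_ ∷ _)  []       = refl
zipWith≡map-zip f (x ∷ xs) (y ∷ ys) = cong (f x y ∷_) (zipWith≡map-zip f xs ys)

data Adjacent {A : Set} : List A → A → A → Set where
  adj-here  : ∀ {p q rest} → Adjacent (p ∷ q ∷ rest) p q
  adj-there : ∀ {x rest p q} → Adjacent rest p q → Adjacent (x ∷ rest) p q

module _ {A : Set} where

  Adjacent-∈ˡ : ∀ {L : List A} {p q} → Adjacent L p q → p ∈ L
  Adjacent-∈ˡ adj-here      = here refl
  Adjacent-∈ˡ (adj-there a) = there (Adjacent-∈ˡ a)

  Adjacent-∈ʳ : ∀ {L : List A} {p q} → Adjacent L p q → q ∈ L
  Adjacent-∈ʳ adj-here      = there (here refl)
  Adjacent-∈ʳ (adj-there a) = there (Adjacent-∈ʳ a)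

  Adjacent⇒Linked : ∀ {R : A → A → Set} (L : List A) → (∀ {p q} → Adjacent L p q → R p q) → Linked R L
  Adjacent⇒Linked []          _ = []
  Adjacent⇒Linked (_ ∷ [])    _ = [-]
  Adjacent⇒Linked (_ ∷ y ∷ L) R = R adj-here ∷ Adjacent⇒Linked (y ∷ L) (R ∘ adj-there)

  Linked⇒Adjacent : ∀ {R : A → A → Set} {L} → Linked R L → ∀ {p q} → Adjacent L p q → R p q
  Linked⇒Adjacent (r ∷ _) adj-here      = r
  Linked⇒Adjacent (_ ∷ l) (adj-there a) = Linked⇒Adjacent l a

  Adjacent-map : ∀ {B : Set} (f : A → B) {L p q} → Adjacent L p q → Adjacent (map f L) (f p) (f q)
  Adjacent-map f adj-here      = adj-here
  Adjacent-map f (adj-there a) = adj-there (Adjacent-map f a)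

  Adjacent-distinct : ∀ {L : List A} → AllPairs _≢_ L → ∀ {p q} → Adjacent L p q → p ≢ q
  Adjacent-distinct ((p≢q ∷ _) ∷ _) adj-here      = p≢q
  Adjacent-distinct (_ ∷ u)         (adj-there a) = Adjacent-distinct u a

  Adjacent-asym : ∀ {L : List A} → AllPairs _≢_ L → ∀ {p q} → Adjacent L p q → ¬ Adjacent L q p
  Adjacent-asym ((p≢q ∷ _) ∷ _) adj-here      adj-here      = p≢q refl
  Adjacent-asym (p≢ ∷ _)        adj-here      (adj-there a) = All¬⇒¬Any p≢ (Adjacent-∈ʳ a)
  Adjacent-asym (p≢ ∷ _)        (adj-there a) adj-here      = All¬⇒¬Any p≢ (Adjacent-∈ʳ a)
  Adjacent-asym (_ ∷ u)         (adj-there a) (adj-there b) = Adjacent-asym u a b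

-- Permutations of [n]

InRange : ℕ → ℕ → Set
InRange n x = 0 < x × x ≤ n

∈-range⁻ : x ∈ range n → InRange n x
∈-range⁻ x∈ with ∈-map⁻ suc x∈
... | _ , i∈ , refl = z<s , ∈-upTo⁻ i∈

∈-range⁺ : InRange n x → x ∈ range n
∈-range⁺ {x = suc x} (_ , x<n) = ∈-map⁺ suc (∈-upTo⁺ x<n)

range-unique : ∀ n → Unique (range n)
range-unique n = Unique.map⁺ suc-injective (Unique.upTo⁺ n)

range-sorted : ∀ n → AllPairs _<_ (range n)
range-sorted n = AllPairs.map⁺ (AllPairs.applyUpTo⁺₁ (λ i → i) n (λ i<j _ → s<s i<j))

length-range : ∀ n → length (range n) ≡ n
length-range n = trans (length-map suc (upTo n)) (length-upTo n)

record Enumeration (n : ℕ) (w : List ℕ) : Set where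
  field
    unique   : Unique w
    sound    : x ∈ w → InRange n x
    complete : InRange n x → x ∈ w

  positive : All (0 <_) w
  positive = All.tabulate (proj₁ ∘ sound)

  unique₀ : Unique (0 ∷ w)
  unique₀ = All.map (λ 0<x 0≡x → <⇒≢ 0<x 0≡x) positive ∷ unique

IsPerm⇒Enumeration : IsPerm n xs → Enumeration n xs
IsPerm⇒Enumeration {n} xs↭ = record
  { unique   = Unique-resp-↭ (↭-sym xs↭) (range-unique n)
  ; sound    = λ x∈ → ∈-range⁻ (∈-resp-↭ xs↭ x∈)
  ; complete = λ x∈[n] → ∈-resp-↭ (↭-sym xs↭) (∈-range⁺ x∈[n]) }

Enumeration⇒IsPerm : Enumeration n xs → IsPerm n xs
Enumeration⇒IsPerm {n} E = ∼bag⇒↭ (unique∧set⇒bag unique (range-unique n)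
  (mk⇔ (∈-range⁺ ∘ sound) (complete ∘ ∈-range⁻)))
  where open Enumeration E

length-IsPerm : IsPerm n xs → length xs ≡ n
length-IsPerm {n} xs↭ = trans (↭-length xs↭) (length-range n)

-- Signs

signed : Bool → ℕ → ℤ
signed b x = if b then - (+ x) else + x

signBit : ℤ → Bool
signBit (+ _)    = false
signBit -[1+ _ ] = true

-- The local definitions of Defs.signs under names of their own:  signs hat prev h ev (x ∷ rest)
-- reduces to  signed (isNegative h ev prev x rest) x ∷ signs hat x (nextHat hat h prev x rest) (not ev) rest.
isRightValley : ℕ → ℕ → List ℕ → Bool
isRightValley prev x rest = (x <ᵇ prev) ∧ headBigger x rest

isLeftPeak : ℕ → ℕ → List ℕ → Bool
isLeftPeak prev x rest = (prev <ᵇ x) ∧ headSmaller x rest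

isNegative : Bool → Bool → ℕ → ℕ → List ℕ → Bool
isNegative h ev prev x rest = (ev ∧ not (isRightValley prev x rest)) ∨ (isRightValley prev x rest ∧ h)

nextHat : (ℕ → Bool) → Bool → ℕ → ℕ → List ℕ → Bool
nextHat hat h prev x rest = if isLeftPeak prev x rest then hat x else h

StartsDown : ℕ → List ℕ → Set
StartsDown prev []      = ⊥
StartsDown prev (x ∷ _) = x < prev

LeftPeakOf : ℕ → List ℕ → ℕ → Set
LeftPeakOf prev []         y = ⊥
LeftPeakOf prev (x ∷ rest) y = (y ≡ x × isLeftPeak prev x rest ≡ true) ⊎ LeftPeakOf x rest y

LeftPeakOf-∈ : ∀ {prev} w → LeftPeakOf prev w y → y ∈ w
LeftPeakOf-∈ (x ∷ rest) (inj₁ (refl , _)) = here refl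
LeftPeakOf-∈ (x ∷ rest) (inj₂ lp)         = there (LeftPeakOf-∈ rest lp)

data Continuation (x : ℕ) (rest : List ℕ) : Set where
  falls : StartsDown x rest → Continuation x rest
  rises : headBigger x rest ≡ true → Continuation x rest

continuation : ∀ {rest} → Unique (x ∷ rest) → Continuation x rest
continuation {rest = []} _ = rises refl
continuation {rest = y ∷ _} ((x≢y ∷ _) ∷ _) with ≢⇒<⊎> x≢y
... | inj₁ x<y = rises (<ᵇ-true x<y)
... | inj₂ y<x = falls y<x

rises⇒¬startsDown : ∀ rest → headBigger x rest ≡ true → ¬ StartsDown x rest
rises⇒¬startsDown {x} (y ∷ _) up y<x = <-asym y<x (<ᵇ-true⁻¹ {x} {y} up)

module _ (prev x : ℕ) where

  rising⇒¬valley : ∀ rest → prev < x → isRightValley prev x rest ≡ false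
  rising⇒¬valley rest prev<x = cong (_∧ headBigger x rest) (<ᵇ-false (<⇒≤ prev<x))

  falls⇒¬valley : ∀ rest → StartsDown x rest → isRightValley prev x rest ≡ false
  falls⇒¬valley (_ ∷ _) y<x = trans (cong ((x <ᵇ prev) ∧_) (<ᵇ-false (<⇒≤ y<x))) (∧-zeroʳ _)

  valley : ∀ rest → x < prev → headBigger x rest ≡ true → isRightValley prev x rest ≡ true
  valley rest x<prev up = cong₂ _∧_ (<ᵇ-true x<prev) up

  falling⇒¬peak : ∀ rest → x < prev → isLeftPeak prev x rest ≡ false
  falling⇒¬peak rest x<prev = cong (_∧ headSmaller x rest) (<ᵇ-false (<⇒≤ x<prev))

  rises⇒¬peak : ∀ rest → headBigger x rest ≡ true → isLeftPeak prev x rest ≡ false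
  rises⇒¬peak []      _  = ∧-zeroʳ _
  rises⇒¬peak (y ∷ _) up = trans (cong ((prev <ᵇ x) ∧_) (<ᵇ-false (<⇒≤ (<ᵇ-true⁻¹ {x} {y} up)))) (∧-zeroʳ _)

  peak : ∀ rest → prev < x → StartsDown x rest → isLeftPeak prev x rest ≡ true
  peak (_ ∷ _) prev<x y<x = cong₂ _∧_ (<ᵇ-true prev<x) (<ᵇ-true y<x)

  peak⇒rising : ∀ rest → isLeftPeak prev x rest ≡ true → prev < x
  peak⇒rising rest isPeak with prev <ᵇ x in e
  ... | true = <ᵇ-true⁻¹ e

  peak⇒startsDown : ∀ rest → isLeftPeak prev x rest ≡ true → StartsDown x rest
  peak⇒startsDown []      isPeak = contradiction (trans (sym (∧-zeroʳ _)) isPeak) λ ()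
  peak⇒startsDown (y ∷ _) isPeak with prev <ᵇ x
  ... | true = <ᵇ-true⁻¹ isPeak

  module _ (rest : List ℕ) where

    isNegative-valley : ∀ h ev → isRightValley prev x rest ≡ true → isNegative h ev prev x rest ≡ h
    isNegative-valley h false isValley = cong (_∧ h) isValley
    isNegative-valley h true  isValley = cong (λ v → not v ∨ (v ∧ h)) isValley

    isNegative-¬valley : ∀ h ev → isRightValley prev x rest ≡ false → isNegative h ev prev x rest ≡ ev
    isNegative-¬valley h false ¬valley = cong (_∧ h) ¬valley
    isNegative-¬valley h true  ¬valley = cong (λ v → not v ∨ (v ∧ h)) ¬valley

    signed-valley : ∀ h ev → isRightValley prev x rest ≡ true → signed (isNegative h ev prev x rest) x ≡ signed h x
    signed-valley h ev isValley = cong (λ b → signed b x) (isNegative-valley h ev isValley)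

    signed-¬valley : ∀ h ev → isRightValley prev x rest ≡ false → signed (isNegative h ev prev x rest) x ≡ signed ev x
    signed-¬valley h ev ¬valley = cong (λ b → signed b x) (isNegative-¬valley h ev ¬valley)

    nextHat-peak : ∀ hat h → isLeftPeak prev x rest ≡ true → nextHat hat h prev x rest ≡ hat x
    nextHat-peak hat h isPeak = cong (λ b → if b then hat x else h) isPeak

    nextHat-¬peak : ∀ hat h → isLeftPeak prev x rest ≡ false → nextHat hat h prev x rest ≡ h
    nextHat-¬peak hat h ¬peak = cong (λ b → if b then hat x else h) ¬peak

∣signed∣ : ∀ b x → ∣ signed b x ∣ ≡ x
∣signed∣ false x       = refl
∣signed∣ true  zero    = refl
∣signed∣ true  (suc x) = refl

signed-signBit : ∀ z → signed (signBit z) ∣ z ∣ ≡ z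
signed-signBit (+ _)    = refl
signed-signBit -[1+ _ ] = refl

signed-injective : ∀ {b b′} → 0 < x → signed b x ≡ signed b′ x → b ≡ b′
signed-injective {b = false} {false} _ _ = refl
signed-injective {b = true}  {true}  _ _ = refl
signed-injective {suc _} {false} {true}  _ ()
signed-injective {suc _} {true}  {false} _ ()

signed<+ : ∀ b → y < x → signed b y <ℤ + x
signed<+         false y<x = +<+ y<x
signed<+ {zero}  true  y<x = +<+ y<x
signed<+ {suc _} true  _   = -<+

-<signed : ∀ b → x < y → - (+ y) <ℤ signed b x
-<signed {y = suc _} false _         = -<+
-<signed {zero}      true  (s≤s _)   = -<+
-<signed {suc _}     true  (s≤s x<y) = -<- x<y

map-∣∣-signs : ∀ hat prev h ev w → map ∣_∣ (signs hat prev h ev w) ≡ w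
map-∣∣-signs hat prev h ev []         = refl
map-∣∣-signs hat prev h ev (x ∷ rest) = cong₂ _∷_ (∣signed∣ (isNegative h ev prev x rest) x)
  (map-∣∣-signs hat x (nextHat hat h prev x rest) (not ev) rest)

Alternating : Bool → List ℤ → Set
Alternating false = Down
Alternating true  = Up

Step : Bool → ℤ → ℤ → Set
Step false a b = b <ℤ a
Step true  a b = a <ℤ b

Alternating-∷⁺ : ∀ ev {a b r} → Step ev a b → Alternating (not ev) (b ∷ r) → Alternating ev (a ∷ b ∷ r)
Alternating-∷⁺ false step alt = step , alt
Alternating-∷⁺ true  step alt = step , alt

Alternating-∷⁻ : ∀ ev {a b r} → Alternating ev (a ∷ b ∷ r) → Step ev a b × Alternating (not ev) (b ∷ r)
Alternating-∷⁻ false alt = alt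
Alternating-∷⁻ true  alt = alt

-- Of two neighbours, the larger one is not a right valley, so its sign is the parity of its position.
signs-alternating : ∀ hat prev h ev w → Unique (prev ∷ w) → Alternating ev (signs hat prev h ev w)
signs-alternating hat prev h false []       _ = tt
signs-alternating hat prev h true  []       _ = tt
signs-alternating hat prev h false (_ ∷ []) _ = tt
signs-alternating hat prev h true  (_ ∷ []) _ = tt
signs-alternating hat prev h ev (x ∷ y ∷ r) (_ ∷ u@((x≢y ∷ _) ∷ _)) =
  Alternating-∷⁺ ev (step ev (≢⇒<⊎> x≢y)) (signs-alternating hat x h′ (not ev) (y ∷ r) u)
  where
  h′ : Bool
  h′ = nextHat hat h prev x (y ∷ r)
  px py : Bool → ℤ
  px parity = signed (isNegative h parity prev x (y ∷ r)) x
  py parity = signed (isNegative h′ (not parity) x y r) y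
  ascent : ∀ parity → x < y → py parity ≡ signed (not parity) y
  ascent parity x<y = signed-¬valley x y r h′ (not parity) (rising⇒¬valley x y r x<y)
  descent : ∀ parity → y < x → px parity ≡ signed parity x
  descent parity y<x = signed-¬valley prev x (y ∷ r) h parity (falls⇒¬valley prev x (y ∷ r) y<x)
  step : ∀ parity → x < y ⊎ y < x → Step parity (px parity) (py parity)
  step false (inj₁ x<y) = subst (_<ℤ px false) (sym (ascent false x<y)) (-<signed _ x<y)
  step false (inj₂ y<x) = subst (py false <ℤ_) (sym (descent false y<x)) (signed<+ _ y<x)
  step true  (inj₁ x<y) = subst (px true <ℤ_) (sym (ascent true x<y)) (signed<+ _ x<y)
  step true  (inj₂ y<x) = subst (_<ℤ py true) (sym (descent true y<x)) (-<signed _ y<x)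

signs-cong : ∀ {hat hat′} prev h ev w → (∀ y → LeftPeakOf prev w y → hat y ≡ hat′ y) →
  signs hat prev h ev w ≡ signs hat′ prev h ev w
signs-cong prev h ev [] _ = refl
signs-cong {hat} {hat′} prev h ev (x ∷ rest) agree = cong (signed (isNegative h ev prev x rest) x ∷_)
  (trans (cong (λ b → signs hat x b (not ev) rest) sameHat)
         (signs-cong x (nextHat hat′ h prev x rest) (not ev) rest (λ y → agree y ∘ inj₂)))
  where
  sameHat : (if isLeftPeak prev x rest then hat x else h) ≡ (if isLeftPeak prev x rest then hat′ x else h)
  sameHat with isLeftPeak prev x rest
  ... | true  = agree x (inj₁ (refl , refl))
  ... | false = refl

-- The sign of the first right valley reveals the incoming h, and hat is read off the same
-- way at every left peak, which hands hat x on to the following letters.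
signs-injective : ∀ {hat hat′ prev h h′ ev} w → Unique (prev ∷ w) → All (0 <_) w →
  signs hat prev h ev w ≡ signs hat′ prev h′ ev w →
  (∀ y → LeftPeakOf prev w y → hat y ≡ hat′ y) × (StartsDown prev w → h ≡ h′)
signs-injective [] _ _ _ = (λ _ ()) , (λ ())
signs-injective {hat} {hat′} {prev} {h} {h′} {ev} (x ∷ rest) (_ ∷ u) (0<x ∷ pos) eq = leftPeaks , startsDown
  where
  open ≡-Reasoning
  IH : (∀ y → LeftPeakOf x rest y → hat y ≡ hat′ y) ×
       (StartsDown x rest → nextHat hat h prev x rest ≡ nextHat hat′ h′ prev x rest)
  IH = signs-injective rest u pos (∷-injectiveʳ eq)
  leftPeaks : ∀ y → LeftPeakOf prev (x ∷ rest) y → hat y ≡ hat′ y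
  leftPeaks y (inj₂ lp) = proj₁ IH y lp
  leftPeaks y (inj₁ (refl , isPeak)) = begin
    hat x                        ≡⟨ nextHat-peak prev x rest hat h isPeak ⟨
    nextHat hat h prev x rest    ≡⟨ proj₂ IH (peak⇒startsDown prev x rest isPeak) ⟩
    nextHat hat′ h′ prev x rest  ≡⟨ nextHat-peak prev x rest hat′ h′ isPeak ⟩
    hat′ x                       ∎
  startsDown : x < prev → h ≡ h′
  startsDown x<prev with continuation u
  ... | falls down = begin
    h                            ≡⟨ nextHat-¬peak prev x rest hat h (falling⇒¬peak prev x rest x<prev) ⟨
    nextHat hat h prev x rest    ≡⟨ proj₂ IH down ⟩
    nextHat hat′ h′ prev x rest  ≡⟨ nextHat-¬peak prev x rest hat′ h′ (falling⇒¬peak prev x rest x<prev) ⟩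
    h′                           ∎
  ... | rises up = begin
    h                            ≡⟨ isNegative-valley prev x rest h ev (valley prev x rest x<prev up) ⟨
    isNegative h ev prev x rest  ≡⟨ signed-injective 0<x (∷-injectiveˡ eq) ⟩
    isNegative h′ ev prev x rest ≡⟨ isNegative-valley prev x rest h′ ev (valley prev x rest x<prev up) ⟩
    h′                           ∎

larger-above⇒positive : ∀ {a b} → ∣ a ∣ < ∣ b ∣ → a <ℤ b → b ≡ signed false ∣ b ∣
larger-above⇒positive {b = + _} _ _ = refl
larger-above⇒positive { -[1+ _ ]} { -[1+ _ ]} (s≤s m<n) (-<- n<m) = contradiction n<m (<-asym m<n)

larger-below⇒negative : ∀ {a b} → ∣ a ∣ < ∣ b ∣ → b <ℤ a → b ≡ signed true ∣ b ∣
larger-below⇒negative {b = -[1+ _ ]} _ _ = refl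
larger-below⇒negative {+ _} {+ _} m<n (+<+ n<m) = contradiction n<m (<-asym m<n)

forced-by-previous : ∀ ev {q p} → Step (not ev) q p → ∣ q ∣ < ∣ p ∣ → p ≡ signed ev ∣ p ∣
forced-by-previous false step lt = larger-above⇒positive lt step
forced-by-previous true  step lt = larger-below⇒negative lt step

forced-by-next : ∀ ev {p r} → Step ev p r → ∣ r ∣ < ∣ p ∣ → p ≡ signed ev ∣ p ∣
forced-by-next false step lt = larger-above⇒positive lt step
forced-by-next true  step lt = larger-below⇒negative lt step

forced-by-next-letter : ∀ ev p ps → StartsDown ∣ p ∣ (map ∣_∣ ps) → Alternating ev (p ∷ ps) → p ≡ signed ev ∣ p ∣
forced-by-next-letter ev p (_ ∷ _) down alt = forced-by-next ev (proj₁ (Alternating-∷⁻ ev alt)) down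

update : (ℕ → Bool) → ℕ → Bool → ℕ → Bool
update f a b z = if z ≡ᵇ a then b else f z

update-same : ∀ f a b → update f a b a ≡ b
update-same f a b = cong (if_then b else f a) (≡ᵇ-true {a} refl)

update-other : ∀ f a b {z} → z ≢ a → update f a b z ≡ f z
update-other f a b {z} z≢a = cong (if_then b else f z) (≡ᵇ-false z≢a)

signs-update : ∀ hat a b prev h ev w → a ∉ w → signs (update hat a b) prev h ev w ≡ signs hat prev h ev w
signs-update hat a b prev h ev w a∉ = signs-cong prev h ev w λ y lp → update-other hat a b λ { refl → a∉ (LeftPeakOf-∈ w lp) }

-- Every sign is dictated by the alternation except that of a right valley, which is the incoming
-- hat value h.  So h₀ is the value needed at the first right valley (relevant only when the word
-- starts down), and hat is set at each left peak to the value needed further on.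
signs-surjective : ∀ {q} ev p → Unique (∣ q ∣ ∷ map ∣_∣ p) → Alternating (not ev) (q ∷ p) →
  ∃₂ λ hat h₀ → ∀ h → (StartsDown ∣ q ∣ (map ∣_∣ p) → h ≡ h₀) → signs hat ∣ q ∣ h ev (map ∣_∣ p) ≡ p
signs-surjective ev [] _ _ = (λ _ → false) , false , λ _ _ → refl
signs-surjective {q} ev (px ∷ pr) ((prev≢a ∷ _) ∷ u) alt = cases (≢⇒<⊎> prev≢a) (continuation u)
  where
  open ≡-Reasoning
  prev a : ℕ
  prev = ∣ q ∣
  a = ∣ px ∣
  rest : List ℕ
  rest = map ∣_∣ pr
  IH : ∃₂ λ hat h₀ → ∀ h → (StartsDown a rest → h ≡ h₀) → signs hat a h (not ev) rest ≡ pr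
  IH = signs-surjective (not ev) pr u (proj₂ (Alternating-∷⁻ (not ev) alt))
  hatᵣ : ℕ → Bool
  hatᵣ = proj₁ IH
  h₀ᵣ : Bool
  h₀ᵣ = proj₁ (proj₂ IH)
  specᵣ : ∀ h → (StartsDown a rest → h ≡ h₀ᵣ) → signs hatᵣ a h (not ev) rest ≡ pr
  specᵣ = proj₂ (proj₂ IH)

  forcedByPrevious : prev < a → px ≡ signed ev a
  forcedByPrevious = forced-by-previous ev (proj₁ (Alternating-∷⁻ (not ev) alt))

  forcedByNext : StartsDown a rest → px ≡ signed ev a
  forcedByNext down = forced-by-next-letter ev px pr down
    (subst (λ b → Alternating b (px ∷ pr)) (not-involutive ev) (proj₂ (Alternating-∷⁻ (not ev) alt)))

  tail : ∀ h → isLeftPeak prev a rest ≡ false → (StartsDown a rest → h ≡ h₀ᵣ) →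
    signs hatᵣ a (nextHat hatᵣ h prev a rest) (not ev) rest ≡ pr
  tail h ¬peak ok =
    trans (cong (λ b → signs hatᵣ a b (not ev) rest) (nextHat-¬peak prev a rest hatᵣ h ¬peak)) (specᵣ h ok)

  peakTail : prev < a → StartsDown a rest → ∀ h →
    signs (update hatᵣ a h₀ᵣ) a (nextHat (update hatᵣ a h₀ᵣ) h prev a rest) (not ev) rest ≡ pr
  peakTail prev<a down h = begin
    signs (update hatᵣ a h₀ᵣ) a (nextHat (update hatᵣ a h₀ᵣ) h prev a rest) (not ev) rest
      ≡⟨ cong (λ b → signs (update hatᵣ a h₀ᵣ) a b (not ev) rest) (trans
           (nextHat-peak prev a rest (update hatᵣ a h₀ᵣ) h (peak prev a rest prev<a down)) (update-same hatᵣ a h₀ᵣ)) ⟩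
    signs (update hatᵣ a h₀ᵣ) a h₀ᵣ (not ev) rest
      ≡⟨ signs-update hatᵣ a h₀ᵣ a h₀ᵣ (not ev) rest (Unique.Unique[x∷xs]⇒x∉xs u) ⟩
    signs hatᵣ a h₀ᵣ (not ev) rest
      ≡⟨ specᵣ h₀ᵣ (λ _ → refl) ⟩
    pr ∎

  cases : prev < a ⊎ a < prev → Continuation a rest →
    ∃₂ λ hat h₀ → ∀ h → (StartsDown prev (a ∷ rest) → h ≡ h₀) → signs hat prev h ev (a ∷ rest) ≡ px ∷ pr
  cases (inj₁ prev<a) (falls down) = update hatᵣ a h₀ᵣ , false , λ h _ → cong₂ _∷_
    (trans (signed-¬valley prev a rest h ev (rising⇒¬valley prev a rest prev<a)) (sym (forcedByPrevious prev<a)))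
    (peakTail prev<a down h)
  cases (inj₁ prev<a) (rises up) = hatᵣ , false , λ h _ → cong₂ _∷_
    (trans (signed-¬valley prev a rest h ev (rising⇒¬valley prev a rest prev<a)) (sym (forcedByPrevious prev<a)))
    (tail h (rises⇒¬peak prev a rest up) (λ down → ⊥-elim (rises⇒¬startsDown rest up down)))
  cases (inj₂ a<prev) (falls down) = hatᵣ , h₀ᵣ , λ h h≡ → cong₂ _∷_
    (trans (signed-¬valley prev a rest h ev (falls⇒¬valley prev a rest down)) (sym (forcedByNext down)))
    (tail h (falling⇒¬peak prev a rest a<prev) (λ _ → h≡ a<prev))
  cases (inj₂ a<prev) (rises up) = hatᵣ , signBit px , λ h h≡ → cong₂ _∷_
    (trans (signed-valley prev a rest h ev (valley prev a rest a<prev up))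
           (trans (cong (λ b → signed b a) (h≡ a<prev)) (signed-signBit px)))
    (tail h (falling⇒¬peak prev a rest a<prev) (λ down → ⊥-elim (rises⇒¬startsDown rest up down)))

-- Orbits

orbit : (ℕ → ℕ) → ℕ → ℕ → List ℕ
orbit f x = applyUpTo (iterate f x)

iterate-suc : ∀ (f : ℕ → ℕ) x t → iterate f x (suc t) ≡ f (iterate f x t)
iterate-suc f x zero    = refl
iterate-suc f x (suc t) = iterate-suc f (f x) t

iterate-+ : ∀ (f : ℕ → ℕ) x s t → iterate f x (s + t) ≡ iterate f (iterate f x s) t
iterate-+ f x zero    t = refl
iterate-+ f x (suc s) t = iterate-+ f (f x) s t

IsPeriod : (ℕ → ℕ) → ℕ → ℕ → Set
IsPeriod f x s = 0 < s × iterate f x s ≡ x × (∀ t → 0 < t → t < s → iterate f x t ≢ x)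

module _ {f : ℕ → ℕ} {x s : ℕ} (period : IsPeriod f x s) where

  private
    0<s : 0 < s
    0<s = proj₁ period
    return : iterate f x s ≡ x
    return = proj₁ (proj₂ period)

  iterate∈orbit : ∀ t → iterate f x t ∈ orbit f x s
  iterate∈orbit = <-rec _ step
    where
    open ≡-Reasoning
    unwind : ∀ {t} → s ≤ t → iterate f x (t ∸ s) ≡ iterate f x t
    unwind {t} s≤t = begin
      iterate f x (t ∸ s)               ≡⟨ cong (λ y → iterate f y (t ∸ s)) return ⟨
      iterate f (iterate f x s) (t ∸ s) ≡⟨ iterate-+ f x s (t ∸ s) ⟨
      iterate f x (s + (t ∸ s))         ≡⟨ cong (iterate f x) (m+[n∸m]≡n s≤t) ⟩
      iterate f x t                     ∎
    step : ∀ t → (∀ {t′} → t′ < t → iterate f x t′ ∈ orbit f x s) → iterate f x t ∈ orbit f x s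
    step t rec with t <? s
    ... | yes t<s = ∈-applyUpTo⁺ (iterate f x) t<s
    ... | no t≮s  = subst (_∈ orbit f x s) (unwind (≮⇒≥ t≮s)) (rec (∸-monoʳ-< 0<s (≮⇒≥ t≮s)))

  orbit-trans : ∀ {c y k} → c ∈ orbit f x s → y ∈ orbit f c k → y ∈ orbit f x s
  orbit-trans c∈ y∈ with ∈-applyUpTo⁻ (iterate f x) c∈ | ∈-applyUpTo⁻ (iterate f _) y∈
  ... | j , _ , refl | t , _ , refl = subst (_∈ orbit f x s) (iterate-+ f x j t) (iterate∈orbit (j + t))

orbit-sym : ∀ {f x s c s′} → IsPeriod f x s → IsPeriod f c s′ → c ∈ orbit f x s → x ∈ orbit f c s′
orbit-sym {f} {x} {s} {c} {s′} period period′ c∈ with ∈-applyUpTo⁻ (iterate f x) c∈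
... | j , j<s , refl = subst (_∈ orbit f c s′) back (iterate∈orbit period′ (s ∸ j))
  where
  back : iterate f (iterate f x j) (s ∸ j) ≡ x
  back = trans (sym (iterate-+ f x j (s ∸ j)))
               (trans (cong (iterate f x) (m+[n∸m]≡n (<⇒≤ j<s))) (proj₁ (proj₂ period)))

-- Defs.cycleFrom runs a local loop that has no name outside Defs.  The metavariable cycleTail
-- is solved by unification with that loop in cycleTail-is-loop, where the with-abstractions
-- present the loop applied to distinct variables.
mutual
  cycleTail : (f : ℕ → ℕ) (fuel m k x : ℕ) → List ℕ
  cycleTail = _

  private
    cycleTail-is-loop : ∀ f fuel m → cycleFrom f (suc fuel) m ≡ cycleFrom f (suc fuel) m
    cycleTail-is-loop f fuel m with f m ≡ᵇ m
    ... | true  = refl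
    ... | false with suc fuel | f (f m)
    ...   | fuel′ | x = cong (λ t → m ∷ f m ∷ t) (refl {x = cycleTail f fuel′ m fuel x})

module _ {f : ℕ → ℕ} {m s : ℕ} (period : IsPeriod f m s) where

  cycleTail-orbit : ∀ {fuel} d k j → j + d ≡ s → 0 < j → d ≤ k →
    cycleTail f fuel m k (iterate f m j) ≡ orbit f (iterate f m j) d
  cycleTail-orbit zero zero _ _ _ _ = refl
  cycleTail-orbit {fuel} zero (suc k) j j+0≡s _ _ =
    cong (λ b → if b then [] else iterate f m j ∷ cycleTail f fuel m k (f (iterate f m j)))
         (≡ᵇ-true (trans (cong (iterate f m) (trans (sym (+-identityʳ j)) j+0≡s)) (proj₁ (proj₂ period))))
  cycleTail-orbit {fuel} (suc d) (suc k) j j+d≡s 0<j (s≤s d≤k) = begin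
    cycleTail f fuel m (suc k) (iterate f m j)
      ≡⟨ cong (λ b → if b then [] else iterate f m j ∷ cycleTail f fuel m k (f (iterate f m j))) (≡ᵇ-false ≢m) ⟩
    iterate f m j ∷ cycleTail f fuel m k (f (iterate f m j))
      ≡⟨ cong (λ y → iterate f m j ∷ cycleTail f fuel m k y) (iterate-suc f m j) ⟨
    iterate f m j ∷ cycleTail f fuel m k (iterate f m (suc j))
      ≡⟨ cong (iterate f m j ∷_) (cycleTail-orbit {fuel} d k (suc j) (trans (sym (+-suc j d)) j+d≡s) z<s d≤k) ⟩
    iterate f m j ∷ orbit f (iterate f m (suc j)) d
      ≡⟨ cong (λ y → iterate f m j ∷ orbit f y d) (iterate-suc f m j) ⟩
    orbit f (iterate f m j) (suc d) ∎
    where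
    open ≡-Reasoning
    ≢m : iterate f m j ≢ m
    ≢m = proj₂ (proj₂ period) j 0<j (subst (j <_) j+d≡s (m<m+n j z<s))

  cycleFrom-orbit : ∀ {fuel} → s ≤ suc fuel → cycleFrom f fuel m ≡ orbit f m s
  cycleFrom-orbit {fuel} (s≤s s′≤fuel) = cong (m ∷_) (cycleTail-orbit {fuel} _ fuel 1 refl z<s s′≤fuel)

-- Injections of [n]

record RangeInjection (n : ℕ) (f : ℕ → ℕ) : Set where
  field
    maps      : InRange n x → InRange n (f x)
    injective : InRange n x → InRange n y → f x ≡ f y → x ≡ y

module _ {n f} (F : RangeInjection n f) where
  open RangeInjection F

  iterate-maps : InRange n x → ∀ t → InRange n (iterate f x t)
  iterate-maps x∈ zero    = x∈
  iterate-maps x∈ (suc t) = iterate-maps (maps x∈) t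

  orbit-maps : ∀ {k} → InRange n x → y ∈ orbit f x k → InRange n y
  orbit-maps x∈ y∈ with ∈-applyUpTo⁻ _ y∈
  ... | t , _ , refl = iterate-maps x∈ t

  iterate-cancel : InRange n x → ∀ i j → i ≤ j → iterate f x i ≡ iterate f x j → iterate f x (j ∸ i) ≡ x
  iterate-cancel x∈ zero    j       _         eq = sym eq
  iterate-cancel {x} x∈ (suc i) (suc j) (s≤s i≤j) eq = injective (iterate-maps x∈ (j ∸ i)) x∈
    (trans (sym (iterate-suc f x (j ∸ i))) (iterate-cancel (maps x∈) i j i≤j eq))

  first-return⇒distinct : InRange n x → ∀ s → (∀ t → 0 < t → t < s → iterate f x t ≢ x) →
    ∀ {i j} → i < j → j < s → iterate f x i ≢ iterate f x j
  first-return⇒distinct {x} x∈ s noReturn {i} {j} i<j j<s eq =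
    noReturn (j ∸ i) (m<n⇒0<n∸m i<j) (≤-<-trans (m∸n≤m j i) j<s) (iterate-cancel x∈ i j (<⇒≤ i<j) eq)

  orbit-unique : ∀ {s} → InRange n x → IsPeriod f x s → Unique (orbit f x s)
  orbit-unique {x} {s} x∈ (_ , _ , noReturn) =
    Unique.applyUpTo⁺₁ (iterate f x) s (first-return⇒distinct x∈ s noReturn)

  returns? : ∀ x t → Dec (0 < t × iterate f x t ≡ x)
  returns? x t = (0 <? t) ×-dec (iterate f x t ≟ x)

  -- Without a return within n steps, the first n + 1 points of the orbit would be distinct points of [n].
  period : InRange n x → ∃ λ s → IsPeriod f x s × s ≤ n
  period {x} x∈ with least-below (λ t → 0 < t × iterate f x t ≡ x) (returns? x) (suc n)
  ... | inj₁ (s , s<1+n , (0<s , ret) , least) =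
    s , (0<s , ret , λ t 0<t t<s e → least t t<s (0<t , e)) , s≤s⁻¹ s<1+n
  ... | inj₂ none = contradiction (unique-⊆⇒length≤ distinct (∈-range⁺ ∘ orbit-maps x∈))
    (subst₂ (λ a b → ¬ a ≤ b) (sym (length-applyUpTo (iterate f x) (suc n))) (sym (length-range n)) 1+n≰n)
    where
    distinct : Unique (orbit f x (suc n))
    distinct = Unique.applyUpTo⁺₁ (iterate f x) (suc n)
      (first-return⇒distinct x∈ (suc n) λ t 0<t t<1+n e → none t t<1+n (0<t , e))

  cycleFrom≡orbit : InRange n x → ∃ λ s → IsPeriod f x s × cycleFrom f n x ≡ orbit f x s
  cycleFrom≡orbit x∈ with period x∈
  ... | s , per , s≤n = s , per , cycleFrom-orbit per (m≤n⇒m≤1+n s≤n)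

-- Standard cycle forms

data StandardCycleForm : ℕ → List (List ℕ) → Set where
  []    : ∀ {lo} → StandardCycleForm lo []
  cycle : ∀ {lo m b Ss} → lo < m → All (_< m) b → StandardCycleForm m Ss → StandardCycleForm lo ((m ∷ b) ∷ Ss)

stepsTo : ℕ → List ℕ → List (ℕ × ℕ)
stepsTo m []          = []
stepsTo m (c ∷ [])    = (c , m) ∷ []
stepsTo m (c ∷ d ∷ t) = (c , d) ∷ stepsTo m (d ∷ t)

cycleSteps : List ℕ → List (ℕ × ℕ)
cycleSteps []      = []
cycleSteps (m ∷ b) = stepsTo m (m ∷ b)

cycleGraph : List (List ℕ) → List (ℕ × ℕ)
cycleGraph []       = []
cycleGraph (S ∷ Ss) = cycleSteps S ++ cycleGraph Ss

graphFunction : List (ℕ × ℕ) → ℕ → ℕ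
graphFunction G = lookupAssoc (map proj₁ G) (map proj₂ G)

Follows : (ℕ → ℕ) → List ℕ → Set
Follows f S = All (λ p → f (proj₁ p) ≡ proj₂ p) (cycleSteps S)

map-proj₁-stepsTo : ∀ m L → map proj₁ (stepsTo m L) ≡ L
map-proj₁-stepsTo m []          = refl
map-proj₁-stepsTo m (c ∷ [])    = refl
map-proj₁-stepsTo m (c ∷ d ∷ t) = cong (c ∷_) (map-proj₁-stepsTo m (d ∷ t))

map-proj₂-stepsTo : ∀ m c t → map proj₂ (stepsTo m (c ∷ t)) ≡ t ++ m ∷ []
map-proj₂-stepsTo m c []      = refl
map-proj₂-stepsTo m c (d ∷ t) = cong (d ∷_) (map-proj₂-stepsTo m d t)

∈-stepsTo⁻ : ∀ m L {p} → p ∈ stepsTo m L → proj₁ p ∈ L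
∈-stepsTo⁻ m L {p} p∈ = subst (proj₁ p ∈_) (map-proj₁-stepsTo m L) (∈-map⁺ proj₁ p∈)

map-proj₁-cycleGraph : ∀ Ss → map proj₁ (cycleGraph Ss) ≡ concat Ss
map-proj₁-cycleGraph []             = refl
map-proj₁-cycleGraph ([] ∷ Ss)      = map-proj₁-cycleGraph Ss
map-proj₁-cycleGraph ((m ∷ b) ∷ Ss) = trans (map-++ proj₁ (cycleSteps (m ∷ b)) (cycleGraph Ss))
  (cong₂ _++_ (map-proj₁-stepsTo m (m ∷ b)) (map-proj₁-cycleGraph Ss))

map-proj₂-cycleGraph : ∀ Ss → map proj₂ (cycleGraph Ss) ↭ concat Ss
map-proj₂-cycleGraph []             = ↭-refl
map-proj₂-cycleGraph ([] ∷ Ss)      = map-proj₂-cycleGraph Ss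
map-proj₂-cycleGraph ((m ∷ b) ∷ Ss) =
  subst (_↭ concat ((m ∷ b) ∷ Ss)) (sym (map-++ proj₂ (cycleSteps (m ∷ b)) (cycleGraph Ss)))
    (↭.++⁺ (subst (_↭ m ∷ b) (sym (map-proj₂-stepsTo m m b)) (↭-sym (∷↭∷ʳ m b))) (map-proj₂-cycleGraph Ss))

∈-cycleGraph⁻ : ∀ Ss {p} → p ∈ cycleGraph Ss → ∃ λ S → S ∈ Ss × p ∈ cycleSteps S
∈-cycleGraph⁻ (S ∷ Ss) p∈ with ∈-++⁻ (cycleSteps S) p∈
... | inj₁ p∈S  = S , here refl , p∈S
... | inj₂ p∈Ss = let S′ , S′∈ , p∈S′ = ∈-cycleGraph⁻ Ss p∈Ss in S′ , there S′∈ , p∈S′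

∈-cycleGraph⁺ : ∀ Ss {S p} → S ∈ Ss → p ∈ cycleSteps S → p ∈ cycleGraph Ss
∈-cycleGraph⁺ (S ∷ Ss) (here refl) p∈ = ∈-++⁺ˡ p∈
∈-cycleGraph⁺ (S ∷ Ss) (there S∈) p∈ = ∈-++⁺ʳ (cycleSteps S) (∈-cycleGraph⁺ Ss S∈ p∈)

Follows-cycleGraph : ∀ {f} Ss → All (Follows f) Ss → ∀ {p} → p ∈ cycleGraph Ss → f (proj₁ p) ≡ proj₂ p
Follows-cycleGraph Ss follows p∈ with ∈-cycleGraph⁻ Ss p∈
... | S , S∈ , p∈S = All.lookup (All.lookup follows S∈) p∈S

-- Prepending x makes it the maximum of a new first cycle, which absorbs the
-- following cycles as long as their maxima are below x.
prepend : ∀ {lo lo′} x acc Ss → All (_< x) acc → StandardCycleForm lo′ Ss → x ∉ concat Ss → lo < x →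
  ∃ λ Ss′ → StandardCycleForm lo Ss′ × concat Ss′ ≡ x ∷ acc ++ concat Ss
prepend x acc [] acc<x [] _ lo<x = ((x ∷ acc) ∷ []) , cycle lo<x acc<x [] , refl
prepend x acc ((m ∷ b) ∷ Ss) acc<x (cycle _ b<m scf) x∉ lo<x with ≢⇒<⊎> {m} {x} (x∉ ∘ here ∘ sym)
... | inj₂ x<m = ((x ∷ acc) ∷ (m ∷ b) ∷ Ss) , cycle lo<x acc<x (cycle x<m b<m scf) , refl
... | inj₁ m<x
  with Ss′ , scf′ , eq ← prepend x (acc ++ m ∷ b) Ss
                             (All-++⁺ acc<x (m<x ∷ All.map (λ c<m → <-trans c<m m<x) b<m)) scf
                             (x∉ ∘ ∈-++⁺ʳ (m ∷ b)) lo<x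
  = Ss′ , scf′ , trans eq (cong (x ∷_) (++-assoc acc (m ∷ b) (concat Ss)))

standardCycleForm : ∀ w → Unique w → All (0 <_) w → ∃ λ Ss → StandardCycleForm 0 Ss × concat Ss ≡ w
standardCycleForm []       _       _          = [] , [] , refl
standardCycleForm (x ∷ w) (x∉ ∷ u) (0<x ∷ pos) with Ss , scf , refl ← standardCycleForm w u pos =
  prepend x [] Ss [] scf (All¬⇒¬Any x∉) 0<x

HeadAbove : ℕ → List ℕ → Set
HeadAbove m []      = ⊤
HeadAbove m (c ∷ _) = m < c

headAbove : ∀ {lo Ss} → StandardCycleForm lo Ss → HeadAbove lo (concat Ss)
headAbove []               = tt
headAbove (cycle lo<m _ _) = lo<m

below-++-unique : ∀ {m} b b′ R R′ → All (_< m) b → All (_< m) b′ → HeadAbove m R → HeadAbove m R′ →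
  b ++ R ≡ b′ ++ R′ → b ≡ b′ × R ≡ R′
below-++-unique []      []       _       _  _         _          _  _  eq = refl , eq
below-++-unique []      (_ ∷ _)  (_ ∷ _) _  _         (c<m ∷ _)  m<c _ refl = contradiction m<c (<-asym c<m)
below-++-unique (_ ∷ _) []       _  (_ ∷ _) (c<m ∷ _) _          _ m<c refl = contradiction m<c (<-asym c<m)
below-++-unique (c ∷ b) (c′ ∷ b′) R R′ (_ ∷ b<m) (_ ∷ b′<m) above above′ eq
  with refl ← ∷-injectiveˡ eq
  with refl , refl ← below-++-unique b b′ R R′ b<m b′<m above above′ (∷-injectiveʳ eq) = refl , refl

standardCycleForm-unique : ∀ {lo lo′ Ss Ss′} → StandardCycleForm lo Ss → StandardCycleForm lo′ Ss′ →
  concat Ss ≡ concat Ss′ → Ss ≡ Ss′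
standardCycleForm-unique []  []  _ = refl
standardCycleForm-unique {Ss = (m ∷ b) ∷ Ss} {(m′ ∷ b′) ∷ Ss′} (cycle _ b<m scf) (cycle _ b′<m′ scf′) eq
  with refl ← ∷-injectiveˡ eq
  with refl , rest ← below-++-unique b b′ (concat Ss) (concat Ss′) b<m b′<m′ (headAbove scf) (headAbove scf′)
                                      (∷-injectiveʳ eq)
  = cong ((m ∷ b) ∷_) (standardCycleForm-unique scf scf′ rest)

head₀ : List ℕ → ℕ
head₀ []      = 0
head₀ (m ∷ _) = m

cycle-nonempty : ∀ {lo Ss S} → StandardCycleForm lo Ss → S ∈ Ss → ∃₂ λ m b → S ≡ m ∷ b
cycle-nonempty (cycle {m = m} {b} _ _ _) (here refl) = m , b , refl
cycle-nonempty (cycle _ _ scf)           (there S∈)  = cycle-nonempty scf S∈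

cycle-below : ∀ {lo Ss m b} → StandardCycleForm lo Ss → (m ∷ b) ∈ Ss → All (_< m) b
cycle-below (cycle _ b<m _) (here refl) = b<m
cycle-below (cycle _ _ scf) (there S∈)  = cycle-below scf S∈

heads-sorted : ∀ {lo Ss} → StandardCycleForm lo Ss →
  All (lo <_) (map head₀ Ss) × AllPairs _<_ (map head₀ Ss)
heads-sorted []                   = [] , []
heads-sorted (cycle lo<m _ scf) with heads-sorted scf
... | m<ms , sorted = (lo<m ∷ All.map (<-trans lo<m) m<ms) , (m<ms ∷ sorted)

-- Left peaks of a standard cycle form

LeftPeakOf-head : ∀ {p rest} → x ∉ rest → LeftPeakOf p (x ∷ rest) x ⇔ (p < x × StartsDown x rest)
LeftPeakOf-head {x} {p} {rest} x∉ = mk⇔ to from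
  where
  to : LeftPeakOf p (x ∷ rest) x → p < x × StartsDown x rest
  to (inj₁ (_ , isPeak)) = peak⇒rising p x rest isPeak , peak⇒startsDown p x rest isPeak
  to (inj₂ lp)           = contradiction (LeftPeakOf-∈ rest lp) x∉
  from : p < x × StartsDown x rest → LeftPeakOf p (x ∷ rest) x
  from (p<x , down) = inj₁ (refl , peak p x rest p<x down)

lastOr : ℕ → List ℕ → ℕ
lastOr p []      = p
lastOr p (c ∷ t) = lastOr c t

lastOr-≤ : ∀ {m} p t → p ≤ m → All (_< m) t → lastOr p t ≤ m
lastOr-≤ p []      p≤m _           = p≤m
lastOr-≤ p (c ∷ t) _   (c<m ∷ t<m) = lastOr-≤ c t (<⇒≤ c<m) t<m

LeftPeakOf-++ : ∀ p S R → x ∉ S → LeftPeakOf p (S ++ R) x ⇔ LeftPeakOf (lastOr p S) R x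
LeftPeakOf-++     p []      R x∉ = mk⇔ (λ lp → lp) (λ lp → lp)
LeftPeakOf-++ {x} p (c ∷ t) R x∉ = mk⇔ to (inj₂ ∘ Equivalence.from IH)
  where
  IH : LeftPeakOf c (t ++ R) x ⇔ LeftPeakOf (lastOr c t) R x
  IH = LeftPeakOf-++ c t R (x∉ ∘ there)
  to : LeftPeakOf p (c ∷ t ++ R) x → LeftPeakOf (lastOr c t) R x
  to (inj₁ (refl , _)) = contradiction (here refl) x∉
  to (inj₂ lp)         = Equivalence.to IH lp

¬startsDown-before : ∀ {m} R → HeadAbove m R → x ≤ m → ¬ StartsDown x R
¬startsDown-before (_ ∷ _) m<c x≤m c<x = <-irrefl refl (<-trans (<-≤-trans c<x x≤m) m<c)

module _ {m : ℕ} {R : List ℕ} (above : HeadAbove m R) where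

  cyclePredecessor-first : ∀ {p c t y} → c ∉ t → c < m → (y , c) ∈ (p , c) ∷ stepsTo m (c ∷ t) → y ≡ p
  cyclePredecessor-first _ _ (here refl) = refl
  cyclePredecessor-first {c = c} {t} c∉ c<m (there y∈)
    with ∈-++⁻ t (subst (c ∈_) (map-proj₂-stepsTo m c t) (∈-map⁺ proj₂ y∈))
  ... | inj₁ c∈t         = contradiction c∈t c∉
  ... | inj₂ (here refl) = contradiction c<m (<-irrefl refl)

  -- Within the cycle the neighbours in the word are the neighbours in the cycle, except that the
  -- last letter is followed in the word by a larger letter (or nothing) and in the cycle by m.
  bodyPeak : ∀ p c t {x y z} → All (_< m) (c ∷ t) → Unique (c ∷ t ++ R) →
    (y , x) ∈ (p , c) ∷ stepsTo m (c ∷ t) → (x , z) ∈ stepsTo m (c ∷ t) →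
    LeftPeakOf p (c ∷ t ++ R) x ⇔ (y < x × z < x)
  bodyPeak p c [] (c<m ∷ _) (c∉ ∷ _) _ (here refl) = mk⇔
    (λ lp → contradiction (proj₂ (Equivalence.to (LeftPeakOf-head (All¬⇒¬Any c∉)) lp))
                          (¬startsDown-before R above (<⇒≤ c<m)))
    (λ (_ , m<c) → contradiction m<c (<-asym c<m))
  bodyPeak p c (d ∷ t) (c<m ∷ _) (c∉ ∷ _) y∈ (here refl)
    with refl ← cyclePredecessor-first {t = d ∷ t} (All¬⇒¬Any c∉ ∘ ∈-++⁺ˡ) c<m y∈
    = LeftPeakOf-head (All¬⇒¬Any c∉)
  bodyPeak p c (d ∷ t) _ (c∉ ∷ _) (here refl) (there x∈) =
    contradiction (∈-++⁺ˡ (∈-stepsTo⁻ m (d ∷ t) x∈)) (All¬⇒¬Any c∉)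
  bodyPeak p c (d ∷ t) (_ ∷ t<m) (c∉ ∷ u) (there y∈) (there x∈) =
    bodyPeak c d t t<m u y∈ x∈ ⇔-∘ LeftPeakOf-++ p (c ∷ []) (d ∷ t ++ R) x∉c
    where
    x∉c : _ ∉ c ∷ []
    x∉c (here refl) = All¬⇒¬Any c∉ (∈-++⁺ˡ (∈-stepsTo⁻ m (d ∷ t) x∈))

  headPeak : ∀ p b {y z} → p < m → All (_< m) b → Unique (m ∷ b ++ R) →
    (y , m) ∈ stepsTo m (m ∷ b) → (m , z) ∈ stepsTo m (m ∷ b) →
    LeftPeakOf p (m ∷ b ++ R) m ⇔ (y < m × z < m)
  headPeak p [] _ _ (m∉ ∷ _) (here refl) (here refl) = mk⇔
    (λ lp → contradiction (proj₂ (Equivalence.to (LeftPeakOf-head (All¬⇒¬Any m∉)) lp))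
                          (¬startsDown-before R above ≤-refl))
    (λ (m<m , _) → contradiction m<m (<-irrefl refl))
  headPeak p (c ∷ t) p<m (c<m ∷ t<m) (m∉ ∷ _) y∈ z∈ =
    mk⇔ (λ _ → predecessor y∈ , successor z∈)
        (λ _ → Equivalence.from (LeftPeakOf-head (All¬⇒¬Any m∉)) (p<m , c<m))
    where
    predecessor : ∀ {y} → (y , m) ∈ stepsTo m (m ∷ c ∷ t) → y < m
    predecessor (here refl) = c<m
    predecessor (there y∈)  = All.lookup (c<m ∷ t<m) (∈-stepsTo⁻ m (c ∷ t) y∈)
    successor : ∀ {z} → (m , z) ∈ stepsTo m (m ∷ c ∷ t) → z < m
    successor (here refl) = c<m
    successor (there m∈)  = contradiction (∈-++⁺ˡ (∈-stepsTo⁻ m (c ∷ t) m∈)) (All¬⇒¬Any m∉)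

  cyclePeak⇔ : ∀ p b {x y z} → p < m → All (_< m) b → Unique (m ∷ b ++ R) →
    (y , x) ∈ stepsTo m (m ∷ b) → (x , z) ∈ stepsTo m (m ∷ b) →
    LeftPeakOf p (m ∷ b ++ R) x ⇔ (y < x × z < x)
  cyclePeak⇔ p []      p<m b<m u y∈ (here refl) = headPeak p [] p<m b<m u y∈ (here refl)
  cyclePeak⇔ p (c ∷ t) p<m b<m u y∈ (here refl) = headPeak p (c ∷ t) p<m b<m u y∈ (here refl)
  cyclePeak⇔ p (c ∷ t) p<m b<m (m∉ ∷ u) y∈ (there x∈) =
    bodyPeak m c t b<m u y∈ x∈ ⇔-∘ LeftPeakOf-++ p (m ∷ []) (c ∷ t ++ R) x∉m
    where
    x∉m : _ ∉ m ∷ []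
    x∉m (here refl) = All¬⇒¬Any m∉ (∈-++⁺ˡ (∈-stepsTo⁻ m (c ∷ t) x∈))

leftPeak⇔cyclePeak : ∀ {lo} Ss p → StandardCycleForm lo Ss → p ≤ lo → Unique (concat Ss) → ∀ {x y z} →
  (y , x) ∈ cycleGraph Ss → (x , z) ∈ cycleGraph Ss → LeftPeakOf p (concat Ss) x ⇔ (y < x × z < x)
leftPeak⇔cyclePeak ((m ∷ b) ∷ Ss) p (cycle lo<m b<m scf) p≤lo u {x} y∈ z∈
  with ∈-++⁻ (cycleSteps (m ∷ b)) y∈ | ∈-++⁻ (cycleSteps (m ∷ b)) z∈
... | inj₁ y∈S | inj₁ z∈S = cyclePeak⇔ (headAbove scf) p b (≤-<-trans p≤lo lo<m) b<m u y∈S z∈S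
... | inj₂ y∈G | inj₂ z∈G =
  leftPeak⇔cyclePeak Ss (lastOr m b) scf (lastOr-≤ m b ≤-refl b<m) (Unique-++⁻ʳ (m ∷ b) u) y∈G z∈G
  ⇔-∘ LeftPeakOf-++ p (m ∷ b) (concat Ss) (λ x∈S → Unique-++⇒disjoint (m ∷ b) u x∈S (source∈ z∈G))
  where
  source∈ : (x , _) ∈ cycleGraph Ss → x ∈ concat Ss
  source∈ z∈G = subst (x ∈_) (map-proj₁-cycleGraph Ss) (∈-map⁺ proj₁ z∈G)
... | inj₁ y∈S | inj₂ z∈G = contradiction (subst (x ∈_) (map-proj₁-cycleGraph Ss) (∈-map⁺ proj₁ z∈G))
  (Unique-++⇒disjoint (m ∷ b) u (target∈ y∈S))
  where
  target∈ : (_ , x) ∈ stepsTo m (m ∷ b) → x ∈ m ∷ b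
  target∈ y∈ with ∈-++⁻ b (subst (x ∈_) (map-proj₂-stepsTo m m b) (∈-map⁺ proj₂ y∈))
  ... | inj₁ x∈b         = there x∈b
  ... | inj₂ (here refl) = here refl
... | inj₂ y∈G | inj₁ z∈S = contradiction (∈-resp-↭ (map-proj₂-cycleGraph Ss) (∈-map⁺ proj₂ y∈G))
  (Unique-++⇒disjoint (m ∷ b) u (∈-stepsTo⁻ m (m ∷ b) z∈S))

-- Foata's map

record IsFoataWord (n : ℕ) (τ : ℕ → ℕ) (w : List ℕ) : Set where
  field
    cycles      : List (List ℕ)
    standard    : StandardCycleForm 0 cycles
    concat≡     : concat cycles ≡ w
    follows     : All (Follows τ) cycles
    enumeration : Enumeration n w

orbit-follows : ∀ f {m} x k → iterate f x (suc k) ≡ m →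
  All (λ p → f (proj₁ p) ≡ proj₂ p) (stepsTo m (orbit f x (suc k)))
orbit-follows f x zero    ret = ret ∷ []
orbit-follows f x (suc k) ret = refl ∷ orbit-follows f (f x) k ret

Follows-orbit : ∀ {f m s} → IsPeriod f m s → Follows f (orbit f m s)
Follows-orbit {f} {m} {suc k} (_ , ret , _) = orbit-follows f m k ret

follows⇒orbit : ∀ f {m} c t → All (λ p → f (proj₁ p) ≡ proj₂ p) (stepsTo m (c ∷ t)) →
  c ∷ t ≡ orbit f c (suc (length t)) × iterate f c (suc (length t)) ≡ m
follows⇒orbit f c []      (ret ∷ [])     = refl , ret
follows⇒orbit f c (_ ∷ t) (refl ∷ steps) = let eq , ret = follows⇒orbit f (f c) t steps in cong (c ∷_) eq , ret

follows⇒period : ∀ {f m b} → Follows f (m ∷ b) → Unique (m ∷ b) →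
  IsPeriod f m (suc (length b)) × m ∷ b ≡ orbit f m (suc (length b))
follows⇒period {f} {m} {b} steps (m∉ ∷ _) = (z<s , ret , noReturn) , eq
  where
  eq : m ∷ b ≡ orbit f m (suc (length b))
  eq = proj₁ (follows⇒orbit f m b steps)
  ret : iterate f m (suc (length b)) ≡ m
  ret = proj₂ (follows⇒orbit f m b steps)
  noReturn : ∀ t → 0 < t → t < suc (length b) → iterate f m t ≢ m
  noReturn (suc t) _ (s≤s t<) e = All¬⇒¬Any m∉
    (subst (_∈ b) e (subst (iterate f (f m) t ∈_) (sym (∷-injectiveʳ eq)) (∈-applyUpTo⁺ (iterate f (f m)) t<)))

Follows-cong : ∀ {f g} S → (∀ {x} → x ∈ S → f x ≡ g x) → Follows f S → Follows g S
Follows-cong []      _   _       = []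
Follows-cong (m ∷ b) f≡g follows = All.tabulate λ p∈ →
  trans (sym (f≡g (∈-stepsTo⁻ m (m ∷ b) p∈))) (All.lookup follows p∈)

isCycleMax⇒ : ∀ {f n m} → T (isCycleMax f n m) → ∀ {y} → y ∈ cycleFrom f n m → y ≤ m
isCycleMax⇒ {f} {n} {m} isMax y∈ = ≤ᵇ⇒≤ _ m (All.lookup (all⁺ (_≤ᵇ m) (cycleFrom f n m) isMax) y∈)

isCycleMax⇐ : ∀ {f n m} → (∀ {y} → y ∈ cycleFrom f n m → y ≤ m) → T (isCycleMax f n m)
isCycleMax⇐ {m = m} below = all⁻ (_≤ᵇ m) (All.tabulate (≤⇒≤ᵇ ∘ below))

module FoataOfInjection {n f} (F : RangeInjection n f) where

  maxima : List ℕ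
  maxima = filterᵇ (isCycleMax f n) (range n)

  maximum-inRange : ∀ {m} → m ∈ maxima → InRange n m
  maximum-inRange = ∈-range⁻ ∘ proj₁ ∘ ∈-filter⁻ (T? ∘ isCycleMax f n) {xs = range n}

  maximum-isCycleMax : ∀ {m} → m ∈ maxima → T (isCycleMax f n m)
  maximum-isCycleMax = proj₂ ∘ ∈-filter⁻ (T? ∘ isCycleMax f n) {xs = range n}

  maxima-sorted : AllPairs _<_ maxima
  maxima-sorted = AllPairs.filter⁺ (T? ∘ isCycleMax f n) (range-sorted n)

  cycle-unique : ∀ {m} → InRange n m → Unique (cycleFrom f n m)
  cycle-unique m∈ = let _ , per , eq = cycleFrom≡orbit F m∈ in subst Unique (sym eq) (orbit-unique F m∈ per)

  cycle-maps : ∀ {m x} → InRange n m → x ∈ cycleFrom f n m → InRange n x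
  cycle-maps m∈ x∈ = let _ , _ , eq = cycleFrom≡orbit F m∈ in orbit-maps F m∈ (subst (_ ∈_) eq x∈)

  tail-below : ∀ {m} → m ∈ maxima → All (_< m) (cycleTail f n m n (f m))
  tail-below {m} m∈ = All.tabulate λ y∈ → ≤∧≢⇒< (isCycleMax⇒ {f} {n} (maximum-isCycleMax m∈) (there y∈))
    λ { refl → Unique.Unique[x∷xs]⇒x∉xs (cycle-unique (maximum-inRange m∈)) y∈ }

  standard : StandardCycleForm 0 (map (cycleFrom f n) maxima)
  standard = build maxima maxima-sorted (All.tabulate (proj₁ ∘ maximum-inRange)) (λ m∈ → m∈)
    where
    build : ∀ {lo} ms → AllPairs _<_ ms → All (lo <_) ms → (∀ {m} → m ∈ ms → m ∈ maxima) →
      StandardCycleForm lo (map (cycleFrom f n) ms)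
    build []       _               _          _  = []
    build (m ∷ ms) (m<ms ∷ sorted) (lo<m ∷ _) ⊆m =
      cycle lo<m (tail-below (⊆m (here refl))) (build ms sorted m<ms (⊆m ∘ there))

  -- A common letter would put the larger maximum into the cycle of the smaller one.
  cycles-disjoint : ∀ {a b} → a ∈ maxima → b ∈ maxima → a < b → Disjoint (cycleFrom f n a) (cycleFrom f n b)
  cycles-disjoint {a} {b} a∈ b∈ a<b (z∈a , z∈b)
    with sa , pa , ea ← cycleFrom≡orbit F (maximum-inRange a∈)
       | sb , pb , eb ← cycleFrom≡orbit F (maximum-inRange b∈)
       | sz , pz , ez ← cycleFrom≡orbit F (cycle-maps (maximum-inRange a∈) z∈a)
    = <⇒≱ a<b (isCycleMax⇒ {f} {n} (maximum-isCycleMax a∈) (subst (b ∈_) (sym ea) b∈a))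
    where
    b∈a : b ∈ orbit f a sa
    b∈a = orbit-trans pa (subst (_ ∈_) ea z∈a) (orbit-sym pb pz (subst (_ ∈_) eb z∈b))

  unique : Unique (foata n f)
  unique = Unique.concat⁺ (All.tabulate cycle∈-unique) (AllPairs.map⁺ (AllPairs-map∈ cycles-disjoint maxima-sorted))
    where
    cycle∈-unique : ∀ {S} → S ∈ map (cycleFrom f n) maxima → Unique S
    cycle∈-unique S∈ with m , m∈ , refl ← ∈-map⁻ (cycleFrom f n) S∈ = cycle-unique (maximum-inRange m∈)

  sound : ∀ {x} → x ∈ foata n f → InRange n x
  sound x∈
    with S , x∈S , S∈ ← ∈-concat⁻′ (map (cycleFrom f n) maxima) x∈
    with m , m∈ , refl ← ∈-map⁻ (cycleFrom f n) S∈
    = cycle-maps (maximum-inRange m∈) x∈S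

  -- x lies in the cycle written from the maximum M of its orbit.
  complete : ∀ {x} → InRange n x → x ∈ foata n f
  complete {x} x∈[n] with suc k , px , _ ← period F x∈[n] = ∈-concat⁺′ x∈M (∈-map⁺ (cycleFrom f n) M∈maxima)
    where
    M : ℕ
    M = max x (orbit f (f x) k)
    M∈orbit : M ∈ orbit f x (suc k)
    M∈orbit = argmax-all (λ y → y) {P = _∈ orbit f x (suc k)} (here refl) (All.tabulate there)
    below-M : ∀ {y} → y ∈ orbit f x (suc k) → y ≤ M
    below-M = All.lookup (⊥≤max x (orbit f (f x) k) ∷ xs≤max x (orbit f (f x) k))
    M-cycle : ∃ λ s → IsPeriod f M s × cycleFrom f n M ≡ orbit f M s
    M-cycle = cycleFrom≡orbit F (orbit-maps F x∈[n] M∈orbit)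
    M∈maxima : M ∈ maxima
    M∈maxima = ∈-filter⁺ (T? ∘ isCycleMax f n) (∈-range⁺ (orbit-maps F x∈[n] M∈orbit))
      (isCycleMax⇐ {f} {n} λ y∈ → below-M (orbit-trans px M∈orbit (subst (_ ∈_) (proj₂ (proj₂ M-cycle)) y∈)))
    x∈M : x ∈ cycleFrom f n M
    x∈M = subst (x ∈_) (sym (proj₂ (proj₂ M-cycle))) (orbit-sym px (proj₁ (proj₂ M-cycle)) M∈orbit)

  follows : All (Follows f) (map (cycleFrom f n) maxima)
  follows = All.tabulate λ S∈ → follows∈ S∈
    where
    follows∈ : ∀ {S} → S ∈ map (cycleFrom f n) maxima → Follows f S
    follows∈ S∈
      with m , m∈ , refl ← ∈-map⁻ (cycleFrom f n) S∈
      with _ , per , eq ← cycleFrom≡orbit F (maximum-inRange m∈)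
      = subst (Follows f) (sym eq) (Follows-orbit per)

  isFoataWord : IsFoataWord n f (foata n f)
  isFoataWord = record
    { cycles      = map (cycleFrom f n) maxima
    ; standard    = standard
    ; concat≡     = refl
    ; follows     = follows
    ; enumeration = record { unique = unique ; sound = sound ; complete = complete }
    }

module FoataWord {n τ w} (F : IsFoataWord n τ w) where
  open IsFoataWord F
  open Enumeration enumeration using (sound; complete)

  unique-concat : Unique (concat cycles)
  unique-concat = subst Unique (sym concat≡) (Enumeration.unique enumeration)

  unique-targets : Unique (map proj₂ (cycleGraph cycles))
  unique-targets = Unique-resp-↭ (↭-sym (map-proj₂-cycleGraph cycles)) unique-concat

  step∈ : ∀ {x} → x ∈ w → (x , τ x) ∈ cycleGraph cycles
  step∈ {x} x∈
    with (_ , y) , p∈ , refl ← ∈-map⁻ proj₁ (subst (x ∈_) (sym (trans (map-proj₁-cycleGraph cycles) concat≡)) x∈)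
    = subst (λ y → (x , y) ∈ cycleGraph cycles) (sym (Follows-cycleGraph cycles follows p∈)) p∈

  source∈ : ∀ {p} → p ∈ cycleGraph cycles → proj₁ p ∈ w
  source∈ p∈ = subst (_ ∈_) (trans (map-proj₁-cycleGraph cycles) concat≡) (∈-map⁺ proj₁ p∈)

  target∈ : ∀ {p} → p ∈ cycleGraph cycles → proj₂ p ∈ w
  target∈ p∈ = subst (_ ∈_) concat≡ (∈-resp-↭ (map-proj₂-cycleGraph cycles) (∈-map⁺ proj₂ p∈))

  τ-maps : ∀ {x} → x ∈ w → τ x ∈ w
  τ-maps = target∈ ∘ step∈

  τ-injective : ∀ {x y} → x ∈ w → y ∈ w → τ x ≡ τ y → x ≡ y
  τ-injective x∈ y∈ e = cong proj₁ (unique-map⇒injective proj₂ unique-targets (step∈ x∈) (step∈ y∈) e)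

  τ-surjective : ∀ {y} → y ∈ w → ∃ λ x → x ∈ w × τ x ≡ y
  τ-surjective {y} y∈
    with (x , _) , p∈ , refl ←
           ∈-map⁻ proj₂ (∈-resp-↭ (↭-sym (map-proj₂-cycleGraph cycles)) (subst (y ∈_) (sym concat≡) y∈))
    = x , source∈ p∈ , Follows-cycleGraph cycles follows p∈

  injection : RangeInjection n τ
  injection = record
    { maps      = λ x∈ → sound (τ-maps (complete x∈))
    ; injective = λ x∈ y∈ → τ-injective (complete x∈) (complete y∈)
    }

  τ-leftPeak⇔cyclePeak : ∀ {x} → x ∈ w → LeftPeakOf 0 w (τ x) ⇔ (x < τ x × τ (τ x) < τ x)
  τ-leftPeak⇔cyclePeak x∈ = subst (λ v → LeftPeakOf 0 v _ ⇔ _) concat≡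
    (leftPeak⇔cyclePeak cycles 0 standard z≤n unique-concat (step∈ x∈) (step∈ (τ-maps x∈)))

  cycle-member : ∀ {S x} → S ∈ cycles → x ∈ S → x ∈ w
  cycle-member S∈ x∈ = subst (_ ∈_) concat≡ (∈-concat⁺′ x∈ S∈)

  cycle-orbit : ∀ {m b} → (m ∷ b) ∈ cycles → IsPeriod τ m (suc (length b)) × m ∷ b ≡ orbit τ m (suc (length b))
  cycle-orbit S∈ = follows⇒period (All.lookup follows S∈) (Unique-concat⁻ cycles unique-concat S∈)

  cycleFrom-cycle : ∀ {m b} → (m ∷ b) ∈ cycles → cycleFrom τ n m ≡ m ∷ b
  cycleFrom-cycle {m} {b} S∈ =
    trans (cycleFrom-orbit (proj₁ (cycle-orbit S∈)) (m≤n⇒m≤1+n length≤n)) (sym (proj₂ (cycle-orbit S∈)))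
    where
    length≤n : length (m ∷ b) ≤ n
    length≤n = subst (length (m ∷ b) ≤_) (length-IsPerm (Enumeration⇒IsPerm enumeration))
      (unique-⊆⇒length≤ (Unique-concat⁻ cycles unique-concat S∈) (cycle-member S∈))

  head-isCycleMax : ∀ {m b} → (m ∷ b) ∈ cycles → T (isCycleMax τ n m)
  head-isCycleMax {m} {b} S∈ = isCycleMax⇐ {τ} {n} λ {y} y∈ → below (subst (y ∈_) (cycleFrom-cycle S∈) y∈)
    where
    below : ∀ {y} → y ∈ m ∷ b → y ≤ m
    below (here refl) = ≤-refl
    below (there y∈b) = <⇒≤ (All.lookup (cycle-below standard S∈) y∈b)

  -- m lies in the cycle of z and exceeds z.
  body-¬isCycleMax : ∀ {m b z} → (m ∷ b) ∈ cycles → z ∈ b → ¬ T (isCycleMax τ n z)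
  body-¬isCycleMax {m} {b} {z} S∈ z∈b isMax
    with sz , pz , ez ← cycleFrom≡orbit injection (sound (cycle-member S∈ (there z∈b)))
    = <⇒≱ (All.lookup (cycle-below standard S∈) z∈b) (isCycleMax⇒ {τ} {n} isMax (subst (m ∈_) (sym ez) m∈z))
    where
    m∈z : m ∈ orbit τ z sz
    m∈z = orbit-sym (proj₁ (cycle-orbit S∈)) pz (subst (z ∈_) (proj₂ (cycle-orbit S∈)) (there z∈b))

  maxima≡heads : filterᵇ (isCycleMax τ n) (range n) ≡ map head₀ cycles
  maxima≡heads =
    sorted-≡ <-asym (AllPairs.filter⁺ (T? ∘ isCycleMax τ n) (range-sorted n)) (proj₂ (heads-sorted standard)) ⊆ ⊇
    where
    ⊆ : ∀ {z} → z ∈ filterᵇ (isCycleMax τ n) (range n) → z ∈ map head₀ cycles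
    ⊆ z∈
      with z∈[n] , isMax ← ∈-filter⁻ (T? ∘ isCycleMax τ n) z∈
      with S , z∈S , S∈ ← ∈-concat⁻′ cycles (subst (_ ∈_) (sym concat≡) (complete (∈-range⁻ z∈[n])))
      with m , b , refl ← cycle-nonempty standard S∈
      with z∈S
    ... | here refl = ∈-map⁺ head₀ S∈
    ... | there z∈b = contradiction isMax (body-¬isCycleMax S∈ z∈b)
    ⊇ : ∀ {z} → z ∈ map head₀ cycles → z ∈ filterᵇ (isCycleMax τ n) (range n)
    ⊇ z∈
      with S , S∈ , refl ← ∈-map⁻ head₀ z∈
      with m , b , refl ← cycle-nonempty standard S∈
      = ∈-filter⁺ (T? ∘ isCycleMax τ n) (∈-range⁺ (sound (cycle-member S∈ (here refl)))) (head-isCycleMax S∈)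

  foata≡ : foata n τ ≡ w
  foata≡ = begin
    concat (map (cycleFrom τ n) (filterᵇ (isCycleMax τ n) (range n)))
      ≡⟨ cong (concat ∘ map (cycleFrom τ n)) maxima≡heads ⟩
    concat (map (cycleFrom τ n) (map head₀ cycles))
      ≡⟨ cong concat (map-∘ cycles) ⟨
    concat (map (cycleFrom τ n ∘ head₀) cycles)
      ≡⟨ cong concat (map-id-local (All.tabulate cycleFrom-head)) ⟩
    concat cycles
      ≡⟨ concat≡ ⟩
    w ∎
    where
    open ≡-Reasoning
    cycleFrom-head : ∀ {S} → S ∈ cycles → cycleFrom τ n (head₀ S) ≡ S
    cycleFrom-head S∈ with _ , _ , refl ← cycle-nonempty standard S∈ = cycleFrom-cycle S∈

foataWord-unique : ∀ {n τ τ′ w} → IsFoataWord n τ w → IsFoataWord n τ′ w →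
  ∀ {x} → x ∈ w → τ x ≡ τ′ x
foataWord-unique F F′ x∈ = sym (Follows-cycleGraph (IsFoataWord.cycles F′) (IsFoataWord.follows F′)
  (subst (λ Ss → _ ∈ cycleGraph Ss) same (FoataWord.step∈ F x∈)))
  where
  same : IsFoataWord.cycles F ≡ IsFoataWord.cycles F′
  same = standardCycleForm-unique (IsFoataWord.standard F) (IsFoataWord.standard F′)
           (trans (IsFoataWord.concat≡ F) (sym (IsFoataWord.concat≡ F′)))

foataWord-exists : ∀ {n w} → Enumeration n w → ∃ λ τ → IsFoataWord n τ w
foataWord-exists {n} {w} E
  with cycles , standard , concat≡ ← standardCycleForm w (Enumeration.unique E) (Enumeration.positive E)
  = graphFunction (cycleGraph cycles) , record
  { cycles      = cycles
  ; standard    = standard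
  ; concat≡     = concat≡
  ; follows     = All.tabulate λ S∈ → All.tabulate λ p∈ → lookupAssoc-∈ proj₁ proj₂
      (subst Unique (sym (trans (map-proj₁-cycleGraph cycles) concat≡)) (Enumeration.unique E))
      (∈-cycleGraph⁺ cycles S∈ p∈)
  ; enumeration = E
  }

IsFoataWord-cong : ∀ {n f g w} → (∀ {x} → InRange n x → f x ≡ g x) → IsFoataWord n f w → IsFoataWord n g w
IsFoataWord-cong {n} f≡g F = record
  { cycles      = cycles
  ; standard    = standard
  ; concat≡     = concat≡
  ; follows     = All.tabulate λ S∈ →
      Follows-cong _ (f≡g ∘ sound ∘ FoataWord.cycle-member F S∈) (All.lookup follows S∈)
  ; enumeration = enumeration
  }
  where
  open IsFoataWord F
  open Enumeration enumeration using (sound)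

-- Weakly increasing pairs

-- A column is named by its entry a in σ (its entry in π is τ a).  key sorts columns by their
-- maximum and puts, of the two columns with maximum k, the one named k first exactly when hat k.
tie : (ℕ → ℕ) → (ℕ → Bool) → ℕ → ℕ
tie τ hat a = if τ a ≤ᵇ a then (if hat a then 0 else 1) else (if hat (τ a) then 1 else 0)

columnMax : (ℕ → ℕ) → ℕ → ℕ
columnMax τ a = a ⊔ τ a

key : (ℕ → ℕ) → (ℕ → Bool) → ℕ → ℕ
key τ hat a = columnMax τ a * 2 + tie τ hat a

tie≤1 : ∀ τ hat a → tie τ hat a ≤ 1
tie≤1 τ hat a with τ a ≤ᵇ a | hat a | hat (τ a)
... | true  | true  | _     = z≤n
... | true  | false | _     = ≤-refl
... | false | _     | true  = ≤-refl
... | false | _     | false = z≤n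

*2+-< : ∀ {m m′ t t′} → m < m′ → t ≤ 1 → m * 2 + t < m′ * 2 + t′
*2+-< {m} {m′} {t} {t′} m<m′ t≤1 = begin-strict
  m * 2 + t   <⟨ +-monoʳ-< (m * 2) (s≤s t≤1) ⟩
  m * 2 + 2   ≡⟨ +-comm (m * 2) 2 ⟩
  suc m * 2   ≤⟨ *-monoˡ-≤ 2 m<m′ ⟩
  m′ * 2      ≤⟨ m≤m+n (m′ * 2) t′ ⟩
  m′ * 2 + t′ ∎
  where open ≤-Reasoning

*2+-≤⇒≤ : ∀ {m m′ t t′} → t′ ≤ 1 → m * 2 + t ≤ m′ * 2 + t′ → m ≤ m′
*2+-≤⇒≤ {m} {m′} t′≤1 le with m ≤? m′
... | yes m≤m′ = m≤m′
... | no  m≰m′ = contradiction le (<⇒≱ (*2+-< (≰⇒> m≰m′) t′≤1))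

-- For a cycle peak k with τ c ≡ k, the two columns of maximum k start with k and with c.
key-order⇒hat : ∀ τ hat {k c} → τ c ≡ k → c < k → τ k < k →
  (key τ hat k ≤ key τ hat c → hat k ≡ true) × (key τ hat c ≤ key τ hat k → hat k ≡ false)
key-order⇒hat τ hat {k} {c} τc≡k c<k τk<k = first , second
  where
  key-k : key τ hat k ≡ k * 2 + (if hat k then 0 else 1)
  key-k = cong₂ (λ m t → m * 2 + t) (m≥n⇒m⊔n≡m (<⇒≤ τk<k))
    (cong (λ b → if b then (if hat k then 0 else 1) else (if hat (τ k) then 1 else 0)) (≤ᵇ-true (<⇒≤ τk<k)))
  tie-c : (if τ c ≤ᵇ c then (if hat c then 0 else 1) else (if hat (τ c) then 1 else 0)) ≡ (if hat k then 1 else 0)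
  tie-c rewrite τc≡k | ≤ᵇ-false c<k = refl
  key-c : key τ hat c ≡ k * 2 + (if hat k then 1 else 0)
  key-c = cong₂ (λ m t → m * 2 + t) (trans (cong (c ⊔_) τc≡k) (m≤n⇒m⊔n≡n (<⇒≤ c<k))) tie-c
  first : key τ hat k ≤ key τ hat c → hat k ≡ true
  first le with hat k | subst₂ _≤_ key-k key-c le
  ... | true  | _   = refl
  ... | false | 1≤0 = contradiction (+-cancelˡ-≤ (k * 2) 1 0 1≤0) λ ()
  second : key τ hat c ≤ key τ hat k → hat k ≡ false
  second le with hat k | subst₂ _≤_ key-c key-k le
  ... | false | _   = refl
  ... | true  | 1≤0 = contradiction (+-cancelˡ-≤ (k * 2) 1 0 1≤0) λ ()

key-cong : ∀ τ τ′ hat hat′ a → τ a ≡ τ′ a → hat a ≡ hat′ a → hat (τ a) ≡ hat′ (τ′ a) →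
  key τ hat a ≡ key τ′ hat′ a
key-cong τ τ′ hat hat′ a τa≡ hat≡ hatτ≡ with τ a | τ′ a | τa≡
... | _ | _ | refl rewrite hat≡ | hatτ≡ = refl

successorPairs : List (ℕ × ℕ) → List (ℕ × ℕ)
successorPairs ps = zip (map proj₁ ps) (drop 1 (map proj₂ ps))

∈-successorPairs⁺ : ∀ {ps p q} → Adjacent ps p q → (proj₁ p , proj₂ q) ∈ successorPairs ps
∈-successorPairs⁺               adj-here      = here refl
∈-successorPairs⁺ {_ ∷ _ ∷ _} (adj-there a) = there (∈-successorPairs⁺ a)

∈-successorPairs⁻ : ∀ ps {z} → z ∈ successorPairs ps →
  ∃₂ λ p q → Adjacent ps p q × z ≡ (proj₁ p , proj₂ q)
∈-successorPairs⁻ (p ∷ q ∷ _) (here refl) = p , q , adj-here , refl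
∈-successorPairs⁻ (_ ∷ q ∷ r) (there z∈) with ∈-successorPairs⁻ (q ∷ r) z∈
... | p′ , q′ , a , eq = p′ , q′ , adj-there a , eq

module WeaklyIncreasing {n σ π} (W : IsWeaklyIncreasing3 n σ π) where

  Eσ : Enumeration n σ
  Eσ = IsPerm⇒Enumeration (proj₁ W)

  Eπ : Enumeration n π
  Eπ = IsPerm⇒Enumeration (proj₁ (proj₂ W))

  τ : ℕ → ℕ
  τ = tau σ π

  hat : ℕ → Bool
  hat = isHatted σ π

  columns : List (ℕ × ℕ)
  columns = zip σ π

  private
    columns-σ : map proj₁ columns ≡ σ
    columns-σ = map-proj₁-zip σ π (trans (length-IsPerm (proj₁ W)) (sym (length-IsPerm (proj₁ (proj₂ W)))))
    columns-π : map proj₂ columns ≡ π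
    columns-π = map-proj₂-zip σ π (trans (length-IsPerm (proj₁ W)) (sym (length-IsPerm (proj₁ (proj₂ W)))))
    unique-σ : Unique (map proj₁ columns)
    unique-σ = subst Unique (sym columns-σ) (Enumeration.unique Eσ)
    unique-π : Unique (map proj₂ columns)
    unique-π = subst Unique (sym columns-π) (Enumeration.unique Eπ)
    shifted : zip σ (drop 1 π) ≡ successorPairs columns
    shifted = sym (cong₂ (λ s t → zip s (drop 1 t)) columns-σ columns-π)
    distinct : AllPairs _≢_ columns
    distinct = AllPairs.map (λ ≢₁ → ≢₁ ∘ cong proj₁) (AllPairs.map⁻ unique-σ)

  column-τ : ∀ {a b} → (a , b) ∈ columns → τ a ≡ b
  column-τ {a} c∈ =
    subst₂ (λ s t → lookupAssoc s t a ≡ _) columns-σ columns-π (lookupAssoc-∈ proj₁ proj₂ unique-σ c∈)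

  column-τ⁻¹ : ∀ {a b} → (a , b) ∈ columns → tauInv σ π b ≡ a
  column-τ⁻¹ {b = b} c∈ =
    subst₂ (λ s t → lookupAssoc t s b ≡ _) columns-σ columns-π (lookupAssoc-∈ proj₂ proj₁ unique-π c∈)

  column∈ : ∀ {a} → a ∈ σ → (a , τ a) ∈ columns
  column∈ {a} a∈ with ∈-map⁻ proj₁ (subst (a ∈_) (sym columns-σ) a∈)
  ... | (_ , b) , c∈ , refl = subst (λ b → (a , b) ∈ columns) (sym (column-τ c∈)) c∈

  column-σ∈ : ∀ {p} → p ∈ columns → InRange n (proj₁ p)
  column-σ∈ c∈ = Enumeration.sound Eσ (subst (_ ∈_) columns-σ (∈-map⁺ proj₁ c∈))

  column-π∈ : ∀ {p} → p ∈ columns → InRange n (proj₂ p)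
  column-π∈ c∈ = Enumeration.sound Eπ (subst (_ ∈_) columns-π (∈-map⁺ proj₂ c∈))

  injection : RangeInjection n τ
  injection = record
    { maps      = λ a∈ → column-π∈ (column∈ (Enumeration.complete Eσ a∈))
    ; injective = λ a∈ b∈ e → cong proj₁ (unique-map⇒injective proj₂ unique-π
        (column∈ (Enumeration.complete Eσ a∈)) (column∈ (Enumeration.complete Eσ b∈)) e)
    }

  π≡map-τ : π ≡ map τ σ
  π≡map-τ = begin
    π                         ≡⟨ columns-π ⟨
    map proj₂ columns         ≡⟨ map-cong-local (All.tabulate (sym ∘ column-τ)) ⟩
    map (τ ∘ proj₁) columns   ≡⟨ map-∘ columns ⟩
    map τ (map proj₁ columns) ≡⟨ cong (map τ) columns-σ ⟩
    map τ σ                   ∎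
    where open ≡-Reasoning

  hatted : ∀ {a b c} → Adjacent columns (a , b) (c , a) → b < a → c < a → hat a ≡ true
  hatted {a} {b} {c} adj b<a c<a = cong₂ _∧_ cyclePeak successor
    where
    cyclePeak : isCyclePeak σ π a ≡ true
    cyclePeak = cong₂ _∧_ (<ᵇ-true (≤-<-trans (proj₁ (column-σ∈ (Adjacent-∈ʳ adj))) c<a))
      (cong₂ _∧_ (trans (cong (_<ᵇ a) (column-τ⁻¹ (Adjacent-∈ʳ adj))) (<ᵇ-true c<a))
                 (trans (cong (_<ᵇ a) (column-τ (Adjacent-∈ˡ adj))) (<ᵇ-true b<a)))
    successor : any (λ q → (proj₁ q ≡ᵇ a) ∧ (proj₂ q ≡ᵇ a)) (zip σ (drop 1 π)) ≡ true
    successor = Equivalence.to T-≡ (any⁺ _ (lose (subst ((a , a) ∈_) (sym shifted) (∈-successorPairs⁺ adj))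
      (Equivalence.from T-≡ (cong₂ _∧_ (≡ᵇ-true {a} refl) (≡ᵇ-true {a} refl)))))

  -- b would be hatted only if the column (b , _) came right before (_ , b).
  unhatted : ∀ {a b d} → Adjacent columns (a , b) (b , d) → hat b ≡ false
  unhatted {a} {b} {d} adj = trans (cong (isCyclePeak σ π b ∧_) noSuccessor) (∧-zeroʳ _)
    where
    f : ℕ × ℕ → Bool
    f q = (proj₁ q ≡ᵇ b) ∧ (proj₂ q ≡ᵇ b)
    noSuccessor : any f (zip σ (drop 1 π)) ≡ false
    noSuccessor with any f (zip σ (drop 1 π)) in e
    ... | false = refl
    ... | true with find (any⁻ f _ (Equivalence.from T-≡ e))
    ...   | z , z∈ , fz with ∈-successorPairs⁻ columns (subst (z ∈_) shifted z∈)
    ...     | p′ , q′ , adj′ , refl =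
      contradiction (subst₂ (Adjacent columns) p′≡ q′≡ adj′) (Adjacent-asym distinct adj)
      where
      fz′ : T (proj₁ p′ ≡ᵇ b) × T (proj₂ q′ ≡ᵇ b)
      fz′ = Equivalence.to T-∧ fz
      p′≡ : p′ ≡ (b , d)
      p′≡ = unique-map⇒injective proj₁ unique-σ (Adjacent-∈ˡ adj′) (Adjacent-∈ʳ adj)
                                 (≡ᵇ⇒≡ _ _ (proj₁ fz′))
      q′≡ : q′ ≡ (a , b)
      q′≡ = unique-map⇒injective proj₂ unique-π (Adjacent-∈ʳ adj′) (Adjacent-∈ˡ adj)
                                 (≡ᵇ⇒≡ _ _ (proj₂ fz′))

  private
    maxima-increase : ∀ {p q} → Adjacent columns p q → proj₁ p ⊔ proj₂ p ≤ proj₁ q ⊔ proj₂ q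
    maxima-increase =
      Linked⇒Adjacent (Linked.map⁻ (subst (Linked _≤_) (zipWith≡map-zip _⊔_ σ π) (proj₂ (proj₂ W))))

    key-column : ∀ {a b} → (a , b) ∈ columns →
      key τ hat a ≡ (a ⊔ b) * 2 + (if b ≤ᵇ a then (if hat a then 0 else 1) else (if hat b then 1 else 0))
    key-column {a} c∈ =
      cong (λ v → (a ⊔ v) * 2 + (if v ≤ᵇ a then (if hat a then 0 else 1) else (if hat v then 1 else 0))) (column-τ c∈)

    sameMax : ∀ {a b c d} → Adjacent columns (a , b) (c , d) → a ⊔ b ≡ c ⊔ d →
      (a ⊔ b) * 2 + (if b ≤ᵇ a then (if hat a then 0 else 1) else (if hat b then 1 else 0))
        < (c ⊔ d) * 2 + (if d ≤ᵇ c then (if hat c then 0 else 1) else (if hat d then 1 else 0))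
    sameMax {a} {b} {c} {d} adj same with b ≤ᵇ a | ≤ᵇ-reflects-≤ b a | d ≤ᵇ c | ≤ᵇ-reflects-≤ d c
    ... | true  | ofʸ b≤a | true  | ofʸ d≤c = contradiction
      (trans (sym (m≥n⇒m⊔n≡m b≤a)) (trans same (m≥n⇒m⊔n≡m d≤c)))
      (Adjacent-distinct unique-σ (Adjacent-map proj₁ adj))
    ... | false | ofⁿ b≰a | false | ofⁿ d≰c = contradiction
      (trans (sym (m≤n⇒m⊔n≡n (<⇒≤ (≰⇒> b≰a)))) (trans same (m≤n⇒m⊔n≡n (<⇒≤ (≰⇒> d≰c)))))
      (Adjacent-distinct unique-π (Adjacent-map proj₂ adj))
    ... | true  | ofʸ b≤a | false | ofⁿ d≰c
      with refl ← trans (sym (m≥n⇒m⊔n≡m b≤a)) (trans same (m≤n⇒m⊔n≡n (<⇒≤ (≰⇒> d≰c))))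
      rewrite hatted adj (≤∧≢⇒< b≤a (Adjacent-distinct unique-π (Adjacent-map proj₂ adj))) (≰⇒> d≰c)
      = subst (λ v → _ < v * 2 + 1) same (+-monoʳ-< _ z<s)
    ... | false | ofⁿ b≰a | true  | ofʸ d≤c
      with refl ← trans (sym (m≤n⇒m⊔n≡n (<⇒≤ (≰⇒> b≰a)))) (trans same (m≥n⇒m⊔n≡m d≤c))
      rewrite unhatted adj
      = subst (λ v → _ < v * 2 + 1) same (+-monoʳ-< _ z<s)

  key-increases : ∀ {p q} → Adjacent columns p q → key τ hat (proj₁ p) < key τ hat (proj₁ q)
  key-increases {a , b} {c , d} adj with m≤n⇒m<n∨m≡n (maxima-increase adj)
  ... | inj₁ max< = *2+-< (subst₂ _<_ (cong (a ⊔_) (sym (column-τ (Adjacent-∈ˡ adj))))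
                                       (cong (c ⊔_) (sym (column-τ (Adjacent-∈ʳ adj)))) max<) (tie≤1 τ hat a)
  ... | inj₂ same = subst₂ _<_ (sym (key-column (Adjacent-∈ˡ adj))) (sym (key-column (Adjacent-∈ʳ adj)))
                               (sameMax adj same)

  σ-sorted : AllPairs (λ a b → key τ hat a < key τ hat b) σ
  σ-sorted = Linked⇒AllPairs <-trans
    (subst (Linked _) columns-σ (Linked.map⁺ (Adjacent⇒Linked columns key-increases)))

  τ⁻¹-τ : ∀ {c} → InRange n c → tauInv σ π (τ c) ≡ c
  τ⁻¹-τ c∈ = column-τ⁻¹ (column∈ (Enumeration.complete Eσ c∈))

  τ-onto : ∀ {a} → InRange n a → ∃ λ c → InRange n c × τ c ≡ a
  τ-onto {a} a∈ with ∈-map⁻ proj₂ (subst (a ∈_) (sym columns-π) (Enumeration.complete Eπ a∈))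
  ... | (c , _) , c∈ , refl = c , column-σ∈ c∈ , column-τ c∈

weaklyIncreasing-unique : ∀ {n σ π σ′ π′} → IsWeaklyIncreasing3 n σ π → IsWeaklyIncreasing3 n σ′ π′ →
  (∀ {a} → InRange n a → tau σ π a ≡ tau σ′ π′ a) →
  (∀ {a} → InRange n a → isHatted σ π a ≡ isHatted σ′ π′ a) →
  σ ≡ σ′ × π ≡ π′
weaklyIncreasing-unique {n} {σ} {π} {σ′} {π′} W W′ τ≡ hat≡ = σ≡σ′ , π≡π′
  where
  module A  = WeaklyIncreasing W
  module A′ = WeaklyIncreasing W′
  open ≡-Reasoning
  key≡ : ∀ {a} → InRange n a → key A.τ A.hat a ≡ key A′.τ A′.hat a
  key≡ a∈ = key-cong A.τ A′.τ A.hat A′.hat _ (τ≡ a∈) (hat≡ a∈)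
    (trans (hat≡ (RangeInjection.maps A.injection a∈)) (cong A′.hat (τ≡ a∈)))
  σ′-sorted : AllPairs (λ a b → key A.τ A.hat a < key A.τ A.hat b) σ′
  σ′-sorted = AllPairs-map∈
    (λ a∈ b∈ → subst₂ _<_ (sym (key≡ (Enumeration.sound A′.Eσ a∈)))
                          (sym (key≡ (Enumeration.sound A′.Eσ b∈))))
    A′.σ-sorted
  σ≡σ′ : σ ≡ σ′
  σ≡σ′ = sorted-≡ <-asym A.σ-sorted σ′-sorted
    (Enumeration.complete A′.Eσ ∘ Enumeration.sound A.Eσ) (Enumeration.complete A.Eσ ∘ Enumeration.sound A′.Eσ)
  π≡π′ : π ≡ π′
  π≡π′ = begin
    π           ≡⟨ A.π≡map-τ ⟩
    map A.τ σ   ≡⟨ map-cong-local (All.tabulate (τ≡ ∘ Enumeration.sound A.Eσ)) ⟩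
    map A′.τ σ  ≡⟨ cong (map A′.τ) σ≡σ′ ⟩
    map A′.τ σ′ ≡⟨ A′.π≡map-τ ⟨
    π′          ∎

zipWith-⊔-map : ∀ (f : ℕ → ℕ) xs → zipWith _⊔_ xs (map f xs) ≡ map (columnMax f) xs
zipWith-⊔-map f []       = refl
zipWith-⊔-map f (x ∷ xs) = cong (x ⊔ f x ∷_) (zipWith-⊔-map f xs)

-- Sorting [n] by key recovers σ from τ and the prescribed hats.
module WeaklyIncreasingOf {n τ} (F : RangeInjection n τ)
  (onto : ∀ {y} → InRange n y → ∃ λ a → InRange n a × τ a ≡ y) (hat₀ : ℕ → Bool) where

  open import Data.List.Sort (On.decTotalOrder ≤-decTotalOrder (key τ hat₀)) using (sort; sort-↭; sort-↗)

  σ : List ℕ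
  σ = sort (range n)

  π : List ℕ
  π = map τ σ

  σ-perm : IsPerm n σ
  σ-perm = sort-↭ (range n)

  private
    Eσ : Enumeration n σ
    Eσ = IsPerm⇒Enumeration σ-perm

  σ-sorted : AllPairs (λ a b → key τ hat₀ a ≤ key τ hat₀ b) σ
  σ-sorted = Linked⇒AllPairs ≤-trans (sort-↗ (range n))

  π-perm : IsPerm n π
  π-perm = Enumeration⇒IsPerm record
    { unique   = AllPairs.map⁺
        (AllPairs-map∈ (λ a∈ b∈ a≢b → a≢b ∘ RangeInjection.injective F (sound a∈) (sound b∈)) unique)
    ; sound    = λ y∈ → let a , a∈ , eq = ∈-map⁻ τ y∈ in
        subst (InRange n) (sym eq) (RangeInjection.maps F (sound a∈))
    ; complete = λ y∈ → let a , a∈ , eq = onto y∈ in subst (_∈ π) eq (∈-map⁺ τ (complete a∈))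
    }
    where open Enumeration Eσ

  weaklyIncreasing : IsWeaklyIncreasing3 n σ π
  weaklyIncreasing = σ-perm , π-perm , subst (Linked _≤_) (sym (zipWith-⊔-map τ σ))
    (Linked.map⁺ (Linked.map (λ {a} {b} → *2+-≤⇒≤ (tie≤1 τ hat₀ b)) (sort-↗ (range n))))

  tau≡ : ∀ {a} → InRange n a → tau σ π a ≡ τ a
  tau≡ a∈ = lookupAssoc-map τ σ (Enumeration.complete Eσ a∈)

  isHatted≡ : ∀ {k c} → InRange n k → InRange n c → τ c ≡ k → c < k → τ k < k → isHatted σ π k ≡ hat₀ k
  isHatted≡ {k} {c} k∈ c∈ τc≡k c<k τk<k = decide (AllPairs-total (AllPairs.zip (σ-sorted , A.σ-sorted))
    (Enumeration.complete Eσ k∈) (Enumeration.complete Eσ c∈) (λ k≡c → <-irrefl (sym k≡c) c<k))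
    where
    module A = WeaklyIncreasing weaklyIncreasing
    Before : ℕ → ℕ → Set
    Before a b = key τ hat₀ a ≤ key τ hat₀ b × key A.τ A.hat a < key A.τ A.hat b
    built : (key τ hat₀ k ≤ key τ hat₀ c → hat₀ k ≡ true) ×
            (key τ hat₀ c ≤ key τ hat₀ k → hat₀ k ≡ false)
    built = key-order⇒hat τ hat₀ τc≡k c<k τk<k
    actual : (key A.τ A.hat k ≤ key A.τ A.hat c → A.hat k ≡ true) ×
             (key A.τ A.hat c ≤ key A.τ A.hat k → A.hat k ≡ false)
    actual = key-order⇒hat A.τ A.hat (trans (tau≡ c∈) τc≡k) c<k (subst (_< k) (sym (tau≡ k∈)) τk<k)
    decide : Before k c ⊎ Before c k → A.hat k ≡ hat₀ k
    decide (inj₁ (k≤c , k<c)) = trans (proj₁ actual (<⇒≤ k<c)) (sym (proj₁ built k≤c))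
    decide (inj₂ (c≤k , c<k)) = trans (proj₂ actual (<⇒≤ c<k)) (sym (proj₂ built c≤k))

-- The bijection

isHatted-¬cyclePeak : ∀ σ π {k} → isCyclePeak σ π k ≡ false → isHatted σ π k ≡ false
isHatted-¬cyclePeak σ π {k} ¬peak =
  cong (_∧ any (λ q → (proj₁ q ≡ᵇ k) ∧ (proj₂ q ≡ᵇ k)) (zip σ (drop 1 π))) ¬peak

isCyclePeak⇒ : ∀ σ π {k} → isCyclePeak σ π k ≡ true → tauInv σ π k < k × tau σ π k < k
isCyclePeak⇒ σ π {k} isPeak =
  let _ , below = Equivalence.to (T-∧ {1 <ᵇ k}) (Equivalence.from T-≡ isPeak)
      inv< , τ< = Equivalence.to (T-∧ {tauInv σ π k <ᵇ k}) below
  in <ᵇ⇒< _ _ inv< , <ᵇ⇒< _ _ τ<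

Φ≡signs-foata : ∀ {n σ} π → IsPerm n σ → Φ σ π ≡ signs (isHatted σ π) 0 false false (foata n (tau σ π))
Φ≡signs-foata {σ = σ} π σ-perm =
  cong (λ k → signs (isHatted σ π) 0 false false (foata k (tau σ π))) (length-IsPerm σ-perm)

signs-snake : ∀ {n w} hat → n ≥ 1 → Enumeration n w → IsSnake n (signs hat 0 false false w)
signs-snake {n} {w} hat n≥1 E =
  subst (_↭ range n) (sym (map-∣∣-signs hat 0 false false w)) (Enumeration⇒IsPerm E) ,
  positiveHead w (complete (s≤s z≤n , n≥1)) positive ,
  signs-alternating hat 0 false false w unique₀
  where
  open Enumeration E
  positiveHead : ∀ w → 1 ∈ w → All (0 <_) w → PositiveHead (signs hat 0 false false w)
  positiveHead (x ∷ rest) _ (0<x ∷ _) =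
    subst (+ 0 <ℤ_) (sym (signed-¬valley 0 x rest false false (rising⇒¬valley 0 x rest 0<x))) (+<+ 0<x)

Φ-snake : ∀ {n σ π} → n ≥ 1 → IsWeaklyIncreasing3 n σ π → IsSnake n (Φ σ π)
Φ-snake {π = π} n≥1 W = subst (IsSnake _) (sym (Φ≡signs-foata π (proj₁ W)))
  (signs-snake _ n≥1 (IsFoataWord.enumeration (FoataOfInjection.isFoataWord (WeaklyIncreasing.injection W))))

-- A hat can only sit on a cycle peak, and the cycle peaks are the left peaks of the Foata word.
isHatted-agree : ∀ {n σ π σ′ π′} → IsWeaklyIncreasing3 n σ π → IsWeaklyIncreasing3 n σ′ π′ →
  (∀ {a} → InRange n a → tau σ π a ≡ tau σ′ π′ a) →
  (∀ y → LeftPeakOf 0 (foata n (tau σ π)) y → isHatted σ π y ≡ isHatted σ′ π′ y) →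
  ∀ {a} → InRange n a → isHatted σ π a ≡ isHatted σ′ π′ a
isHatted-agree {n} {σ} {π} {σ′} {π′} W W′ τ≡ leftPeaks≡ a∈
  with c , c∈ , refl ← WeaklyIncreasing.τ-onto W a∈ = hatAt c∈ _ refl
  where
  module A  = WeaklyIncreasing W
  module A′ = WeaklyIncreasing W′
  F : IsFoataWord n A.τ (foata n A.τ)
  F = FoataOfInjection.isFoataWord A.injection
  hatAt : ∀ {c} → InRange n c → ∀ b → isCyclePeak σ π (A.τ c) ≡ b → A.hat (A.τ c) ≡ A′.hat (A.τ c)
  hatAt {c} c∈ false ¬peak =
    trans (isHatted-¬cyclePeak σ π ¬peak) (sym (isHatted-¬cyclePeak σ′ π′ (trans (sym cyclePeak≡) ¬peak)))
    where
    cyclePeak≡ : isCyclePeak σ π (A.τ c) ≡ isCyclePeak σ′ π′ (A.τ c)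
    cyclePeak≡ = cong₂ (λ u v → (1 <ᵇ A.τ c) ∧ (u <ᵇ A.τ c) ∧ (v <ᵇ A.τ c))
      (trans (A.τ⁻¹-τ c∈) (sym (trans (cong (tauInv σ′ π′) (τ≡ c∈)) (A′.τ⁻¹-τ c∈))))
      (τ≡ (RangeInjection.maps A.injection c∈))
  hatAt {c} c∈ true isPeak = leftPeaks≡ (A.τ c)
    (Equivalence.from (FoataWord.τ-leftPeak⇔cyclePeak F (Enumeration.complete (IsFoataWord.enumeration F) c∈))
      (subst (_< A.τ c) (A.τ⁻¹-τ c∈) (proj₁ (isCyclePeak⇒ σ π isPeak)) , proj₂ (isCyclePeak⇒ σ π isPeak)))

Φ-injective : ∀ {n σ π σ′ π′} → IsWeaklyIncreasing3 n σ π → IsWeaklyIncreasing3 n σ′ π′ →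
  Φ σ π ≡ Φ σ′ π′ → σ ≡ σ′ × π ≡ π′
Φ-injective {n} {σ} {π} {σ′} {π′} W W′ Φ≡ = weaklyIncreasing-unique W W′ τ≡ (isHatted-agree W W′ τ≡ leftPeaks≡)
  where
  module A  = WeaklyIncreasing W
  module A′ = WeaklyIncreasing W′
  F : IsFoataWord n A.τ (foata n A.τ)
  F = FoataOfInjection.isFoataWord A.injection
  F′ : IsFoataWord n A′.τ (foata n A′.τ)
  F′ = FoataOfInjection.isFoataWord A′.injection
  open Enumeration (IsFoataWord.enumeration F)
  signs≡ : signs A.hat 0 false false (foata n A.τ) ≡ signs A′.hat 0 false false (foata n A′.τ)
  signs≡ = trans (sym (Φ≡signs-foata π (proj₁ W))) (trans Φ≡ (Φ≡signs-foata π′ (proj₁ W′)))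
  w≡w′ : foata n A.τ ≡ foata n A′.τ
  w≡w′ = trans (sym (map-∣∣-signs A.hat 0 false false _))
               (trans (cong (map ∣_∣) signs≡) (map-∣∣-signs A′.hat 0 false false _))
  τ≡ : ∀ {a} → InRange n a → A.τ a ≡ A′.τ a
  τ≡ a∈ = foataWord-unique F (subst (IsFoataWord n A′.τ) (sym w≡w′) F′) (complete a∈)
  leftPeaks≡ : ∀ y → LeftPeakOf 0 (foata n A.τ) y → A.hat y ≡ A′.hat y
  leftPeaks≡ = proj₁ (signs-injective _ unique₀ positive
    (subst (λ v → signs A.hat 0 false false (foata n A.τ) ≡ signs A′.hat 0 false false v) (sym w≡w′) signs≡))

¬startsDown-zero : ∀ w → ¬ StartsDown 0 w
¬startsDown-zero (_ ∷ _) ()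

Φ-surjective : ∀ {n p} → IsSnake n p → ∃₂ λ σ π → IsWeaklyIncreasing3 n σ π × Φ σ π ≡ p
Φ-surjective {n} {p} (signedPerm , positiveHead , down) = C.σ , C.π , C.weaklyIncreasing , Φσπ≡p
  where
  w : List ℕ
  w = map ∣_∣ p
  E : Enumeration n w
  E = IsPerm⇒Enumeration signedPerm
  open Enumeration E
  afterZero : ∀ p → PositiveHead p → Down p → Alternating true (+ 0 ∷ p)
  afterZero (_ ∷ _) 0<x down = 0<x , down
  hatting : ∃₂ λ hat h₀ → ∀ h → (StartsDown 0 w → h ≡ h₀) → signs hat 0 h false w ≡ p
  hatting = signs-surjective {+ 0} false p unique₀ (afterZero p positiveHead down)
  hat₀ : ℕ → Bool
  hat₀ = proj₁ hatting
  signs≡p : signs hat₀ 0 false false w ≡ p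
  signs≡p = proj₂ (proj₂ hatting) false λ down → contradiction down (¬startsDown-zero w)
  τ : ℕ → ℕ
  τ = proj₁ (foataWord-exists E)
  F : IsFoataWord n τ w
  F = proj₂ (foataWord-exists E)
  module FW = FoataWord F
  onto : ∀ {y} → InRange n y → ∃ λ x → InRange n x × τ x ≡ y
  onto y∈ = let x , x∈ , eq = FW.τ-surjective (complete y∈) in x , sound x∈ , eq
  module C = WeaklyIncreasingOf FW.injection onto hat₀
  foata≡ : foata n (tau C.σ C.π) ≡ w
  foata≡ = FoataWord.foata≡ (IsFoataWord-cong (sym ∘ C.tau≡) F)
  hats : ∀ y → LeftPeakOf 0 w y → isHatted C.σ C.π y ≡ hat₀ y
  hats y lp with FW.τ-surjective (LeftPeakOf-∈ w lp)
  ... | c , c∈ , refl = let c<y , τy<y = Equivalence.to (FW.τ-leftPeak⇔cyclePeak c∈) lp in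
    C.isHatted≡ (sound (LeftPeakOf-∈ w lp)) (sound c∈) refl c<y τy<y
  Φσπ≡p : Φ C.σ C.π ≡ p
  Φσπ≡p = begin
    Φ C.σ C.π                                                       ≡⟨ Φ≡signs-foata C.π C.σ-perm ⟩
    signs (isHatted C.σ C.π) 0 false false (foata n (tau C.σ C.π)) ≡⟨ cong (signs _ 0 false false) foata≡ ⟩
    signs (isHatted C.σ C.π) 0 false false w                        ≡⟨ signs-cong 0 false false w hats ⟩
    signs hat₀ 0 false false w                                      ≡⟨ signs≡p ⟩
    p                                                               ∎
    where open ≡-Reasoning

mainTheorem1 : (n : ℕ) → n ≥ 1 →
    -- well-defined: Φ maps 𝔚ₙ into 𝒮ₙ
    ((σ π : List ℕ) → IsWeaklyIncreasing3 n σ π → IsSnake n (Φ σ π))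
    -- injective on 𝔚ₙ
    × ((σ π σ' π' : List ℕ) → IsWeaklyIncreasing3 n σ π → IsWeaklyIncreasing3 n σ' π' →
         Φ σ π ≡ Φ σ' π' → (σ ≡ σ') × (π ≡ π'))
    -- surjective onto 𝒮ₙ
    × ((p : List ℤ) → IsSnake n p →
         ∃₂ λ (σ π : List ℕ) → IsWeaklyIncreasing3 n σ π × (Φ σ π ≡ p))
mainTheorem1 n n≥1 =
  (λ _ _ → Φ-snake n≥1) ,
  (λ _ _ _ _ → Φ-injective) ,
  (λ _ → Φ-surjective)
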